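{- Let $U$ be a lattice and $m\ge1$. Two isometric embeddings $\mathrm{A}_m\to U$ lie in the same $\mathrm{W}(U)^{\pm}$-orbit if and only if their images lie in the same $\mathrm{W}(U)$-orbit (of sublattices of $U$).
   Context: A lattice is an integral Euclidean lattice (positive definite $\mathbb{Z}$-valued symmetric bilinear form). $\mathrm{A}_m$ is the root lattice of type $A_m$. $\mathrm{W}(U)$ is the group generated by the reflections $s_\alpha(x)=x-(x\cdot\alpha)\alpha$ for $\alpha\in U$ of norm $2$, and $\mathrm{W}(U)^{\pm}$ is the group generated by $\mathrm{W}(U)$ and $-\mathrm{id}_U$; these groups act on embeddings by post-composition. -}

module Defs where

open import Data.Nat using (ℕ; suc)
open import Data.Fin using (Fin; toℕ)
open import Data.Integer using (ℤ; 0ℤ; 1ℤ; _+_; _*_; -_; _-_; _<_; +_; -[1+_])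
open import Data.Vec using (Vec; []; _∷_; lookup; tabulate; replicate; map; zipWith; foldr)
open import Data.List using (List)
import Data.List as L
open import Data.Product using (Σ; ∃; _×_; _,_)
open import Relation.Binary.PropositionalEquality using (_≡_; _≢_)
open import Relation.Nullary using (yes; no)
import Data.Nat as N

Vecℤ : ℕ → Set
Vecℤ n = Vec ℤ n

sumV : ∀ {n} → Vec ℤ n → ℤ
sumV = foldr _ _+_ 0ℤ

_+ᵥ_ : ∀ {n} → Vecℤ n → Vecℤ n → Vecℤ n
_+ᵥ_ = zipWith _+_

_•_ : ∀ {n} → ℤ → Vecℤ n → Vecℤ n
c • v = map (c *_) v

-ᵥ_ : ∀ {n} → Vecℤ n → Vecℤ n
-ᵥ_ = map (λ z → - z)

_-ᵥ_ : ∀ {n} → Vecℤ n → Vecℤ n → Vecℤ n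
x -ᵥ y = x +ᵥ (-ᵥ y)

zeroV : ∀ {n} → Vecℤ n
zeroV {n} = replicate n 0ℤ

Gram : ℕ → Set
Gram n = Fin n → Fin n → ℤ

bform : ∀ {n} → Gram n → Vecℤ n → Vecℤ n → ℤ
bform {n} G x y = sumV (tabulate λ i → sumV (tabulate λ j → lookup x i * G i j * lookup y j))

record Lattice : Set where
  field
    rank      : ℕ
    gram      : Gram rank
    symmetric : ∀ i j → gram i j ≡ gram j i
    posdef    : ∀ (x : Vecℤ rank) → x ≢ zeroV → 0ℤ < bform gram x x
open Lattice public

El : Lattice → Set
El U = Vecℤ (rank U)

⟨_⟩[_,_] : (U : Lattice) → El U → El U → ℤ
⟨ U ⟩[ x , y ] = bform (gram U) x y

-- The root lattice A_m: ℤ^m in the basis of simple roots, Gram matrix = Cartan matrix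
-- (2 on the diagonal, -1 for adjacent simple roots, 0 otherwise).
cartanA : (m : ℕ) → Gram m
cartanA m i j with toℕ i N.≟ toℕ j
... | yes _ = + 2
... | no _ with suc (toℕ i) N.≟ toℕ j | suc (toℕ j) N.≟ toℕ i
...   | yes _ | _ = -[1+ 0 ]
...   | no _ | yes _ = -[1+ 0 ]
...   | no _ | no _ = 0ℤ

formA : (m : ℕ) → Vecℤ m → Vecℤ m → ℤ
formA m = bform (cartanA m)

-- A ℤ-linear map ℤ^m → U, given by the images of the standard basis vectors
LinMap : ℕ → Lattice → Set
LinMap m U = Vec (El U) m

apply : ∀ {m U} → LinMap m U → Vecℤ m → El U
apply {m} {U} f x = foldr _ _+ᵥ_ zeroV (zipWith _•_ x f)

record IsoEmb (m : ℕ) (U : Lattice) : Set where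
  field
    map₀     : LinMap m U
    isometry : ∀ x y → ⟨ U ⟩[ apply {m} {U} map₀ x , apply {m} {U} map₀ y ] ≡ formA m x y
open IsoEmb public

Root : Lattice → Set
Root U = Σ (El U) λ α → ⟨ U ⟩[ α , α ] ≡ + 2

reflect : (U : Lattice) → El U → El U → El U
reflect U α x = x -ᵥ (⟨ U ⟩[ x , α ] • α)

-- Elements of W(U): words in the generating reflections (each an involution),
-- acting as the composition s_{α₁} ∘ ... ∘ s_{αₖ}.
WordW : Lattice → Set
WordW U = List (Root U)

actW : (U : Lattice) → WordW U → El U → El U
actW U L.[] x = x
actW U ((α , _) L.∷ w) x = reflect U α (actW U w x)

data GenW± (U : Lattice) : Set where
  refl-gen : Root U → GenW± U
  neg-gen  : GenW± U

WordW± : Lattice → Set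
WordW± U = List (GenW± U)

actGen± : (U : Lattice) → GenW± U → El U → El U
actGen± U (refl-gen (α , _)) x = reflect U α x
actGen± U neg-gen x = -ᵥ x

actW± : (U : Lattice) → WordW± U → El U → El U
actW± U L.[] x = x
actW± U (g L.∷ w) x = actGen± U g (actW± U w x)

SameOrbitW± : ∀ {m U} → IsoEmb m U → IsoEmb m U → Set
SameOrbitW± {m} {U} e e' =
  ∃ λ (g : WordW± U) → ∀ (x : Vecℤ m) → actW± U g (apply {m} {U} (map₀ e) x) ≡ apply {m} {U} (map₀ e') x

_∈Im_ : ∀ {m U} → El U → IsoEmb m U → Set
_∈Im_ {m} {U} y e = ∃ λ (x : Vecℤ m) → apply {m} {U} (map₀ e) x ≡ y

ImagesSameOrbitW : ∀ {m U} → IsoEmb m U → IsoEmb m U → Set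
ImagesSameOrbitW {m} {U} e e' =
  ∃ λ (w : WordW U) → ∀ (y : El U) →
    (y ∈Im e' → ∃ λ (x : El U) → x ∈Im e × actW U w x ≡ y) ×
    ((∃ λ (x : El U) → x ∈Im e × actW U w x ≡ y) → y ∈Im e')

-- An element of W(U)^± is ±w with w ∈ W(U), since −id commutes with reflections, and ±w∘e
-- has image w(Im e). Conversely, if w(Im e) = Im e′ then e′⁻¹∘w∘e is an isometry of A_m, and
-- every isometry of A_m is ± an element of W(A_m); carrying its reflections along e′ gives a
-- word of W(U)^± taking e to e′. For Aut(A_m) = ±W(A_m) use the model
-- A_m = {x ∈ ℤ^(m+1) | Σ x = 0}, α_k = ε_k − ε_(k+1): its roots are the ε_a − ε_b, the images of
-- the α_k under an isometry have the Gram matrix of a path and hence are ±(ε_p(k) − ε_p(k+1))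
-- for a permutation p, and W(A_m) contains every permutation of coordinates.
module Submission where

open import Defs
open import Data.Nat as ℕ using (ℕ; zero; suc; _≤_)
import Data.Nat.Properties as ℕₚ
open import Data.Fin as Fin using (Fin; zero; suc; toℕ; inject₁)
import Data.Fin.Properties as Finₚ
import Data.Fin.Permutation.Components as PC
open import Data.Fin.Permutation using (lift₀-transpose)
open import Data.Integer using (ℤ; +_; -[1+_]; 0ℤ; 1ℤ; -1ℤ; _+_; _*_; -_; _-_; ∣_∣)
import Data.Integer.Properties as ℤₚ
open import Data.Integer.Tactic.RingSolver using (solve-∀)
open import Algebra.Properties.Semiring.Sum ℤₚ.+-*-semiring
  using (sum; sum-cong-≗; ∑-distrib-+; ∑-comm; *-distribˡ-sum; sum-replicate-zero)
open import Data.Vec using (Vec; []; _∷_; lookup; tabulate; map; foldr; zipWith)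
open import Data.Vec.Properties
  using (lookup-map; lookup-zipWith; lookup-replicate; lookup∘tabulate; tabulate∘lookup; tabulate-cong; tabulate-∘)
open import Data.List as List using (List)
open import Data.Product using (Σ-syntax; ∃; _×_; _,_; proj₁; proj₂)
open import Data.Sum using (_⊎_; inj₁; inj₂)
open import Data.Bool using (Bool; true; false; not)
open import Data.Empty using (⊥-elim)
open import Function using (_∘_)
open import Function.Definitions using (Injective)
open import Data.Fin.Patterns using (0F; 1F; 2F)
open import Data.Unit using (⊤; tt)
open import Relation.Binary.PropositionalEquality
open import Relation.Nullary using (yes; no; ¬_)

private
  variable
    m n k : ℕ

vec-ext : ∀ {A : Set} {x y : Vec A n} → (∀ i → lookup x i ≡ lookup y i) → x ≡ y
vec-ext {x = x} {y} x≗y = trans (sym (tabulate∘lookup x)) (trans (tabulate-cong x≗y) (tabulate∘lookup y))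

sumV-tabulate : (f : Fin n → ℤ) → sumV (tabulate f) ≡ sum f
sumV-tabulate {zero} f = refl
sumV-tabulate {suc n} f = cong (_+_ (f zero)) (sumV-tabulate (f ∘ suc))

sumV-∑ : (y : Vecℤ n) → sumV y ≡ sum (lookup y)
sumV-∑ y = trans (cong sumV (sym (tabulate∘lookup y))) (sumV-tabulate (lookup y))

∑-linear : ∀ a b (f g : Fin n → ℤ) → sum (λ i → a * f i + b * g i) ≡ a * sum f + b * sum g
∑-linear a b f g =
  trans (∑-distrib-+ (λ i → a * f i) (λ i → b * g i))
        (sym (cong₂ _+_ (*-distribˡ-sum a f) (*-distribˡ-sum b g)))

δ : Fin n → Fin n → ℤ
δ zero    zero    = 1ℤ
δ zero    (suc _) = 0ℤ
δ (suc _) zero    = 0ℤ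
δ (suc i) (suc j) = δ i j

δ-refl : (i : Fin n) → δ i i ≡ 1ℤ
δ-refl zero    = refl
δ-refl (suc i) = δ-refl i

δ-≢ : {i j : Fin n} → i ≢ j → δ i j ≡ 0ℤ
δ-≢ {i = zero}  {zero}  i≢j = ⊥-elim (i≢j refl)
δ-≢ {i = zero}  {suc j} i≢j = refl
δ-≢ {i = suc i} {zero}  i≢j = refl
δ-≢ {i = suc i} {suc j} i≢j = δ-≢ (i≢j ∘ cong suc)

δ-sym : (i j : Fin n) → δ i j ≡ δ j i
δ-sym zero    zero    = refl
δ-sym zero    (suc j) = refl
δ-sym (suc i) zero    = refl
δ-sym (suc i) (suc j) = δ-sym i j

∑-δ : (k : Fin n) (f : Fin n → ℤ) → sum (λ i → δ k i * f i) ≡ f k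
∑-δ {suc n} zero f = begin
  1ℤ * f zero + sum (λ i → 0ℤ * f (suc i))
    ≡⟨ cong₂ _+_ (ℤₚ.*-identityˡ (f zero)) (sum-cong-≗ (λ i → ℤₚ.*-zeroˡ (f (suc i)))) ⟩
  f zero + sum {n} (λ _ → 0ℤ)              ≡⟨ cong (_+_ (f zero)) (sum-replicate-zero n) ⟩
  f zero + 0ℤ                              ≡⟨ ℤₚ.+-identityʳ (f zero) ⟩
  f zero                                   ∎
  where open ≡-Reasoning
∑-δ {suc n} (suc k) f =
  trans (cong (λ t → t + sum (λ i → δ k i * f (suc i))) (ℤₚ.*-zeroˡ (f zero)))
        (trans (ℤₚ.+-identityˡ _) (∑-δ k (f ∘ suc)))

∑-δʳ : (k : Fin n) (f : Fin n → ℤ) → sum (λ i → f i * δ k i) ≡ f k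
∑-δʳ k f = trans (sum-cong-≗ (λ i → ℤₚ.*-comm (f i) (δ k i))) (∑-δ k f)

∑-δ≡1 : (a : Fin n) → sum (δ a) ≡ 1ℤ
∑-δ≡1 a = trans (sum-cong-≗ (λ c → sym (ℤₚ.*-identityʳ (δ a c)))) (∑-δ a (λ _ → 1ℤ))

ε : Fin n → Vecℤ n
ε k = tabulate (δ k)

lookup-ε : (k i : Fin n) → lookup (ε k) i ≡ δ k i
lookup-ε k = lookup∘tabulate (δ k)

lookup-+ᵥ : (x y : Vecℤ n) (i : Fin n) → lookup (x +ᵥ y) i ≡ lookup x i + lookup y i
lookup-+ᵥ x y i = lookup-zipWith _+_ i x y

lookup-• : (c : ℤ) (x : Vecℤ n) (i : Fin n) → lookup (c • x) i ≡ c * lookup x i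
lookup-• c x i = lookup-map i (c *_) x

lookup-negᵥ : (x : Vecℤ n) (i : Fin n) → lookup (-ᵥ x) i ≡ - lookup x i
lookup-negᵥ x i = lookup-map i -_ x

lookup-zeroV : (i : Fin n) → lookup (zeroV {n}) i ≡ 0ℤ
lookup-zeroV {n} i = lookup-replicate i 0ℤ

-- A record rather than a function type, so that w, a, x, b and y can be inferred from a proof.
record LinComb (w : Vecℤ n) (a : ℤ) (x : Vecℤ n) (b : ℤ) (y : Vecℤ n) : Set where
  constructor pointwise
  field at : ∀ i → lookup w i ≡ a * lookup x i + b * lookup y i
open LinComb public

zeroV-lincomb : LinComb (zeroV {n}) 0ℤ zeroV 0ℤ zeroV
zeroV-lincomb = pointwise λ i → trans (lookup-zeroV i) (sym (annihilate (lookup zeroV i)))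
  where
  annihilate : ∀ t → 0ℤ * t + 0ℤ * t ≡ 0ℤ
  annihilate = solve-∀

+ᵥ-lincomb : (a : ℤ) (x y : Vecℤ n) → LinComb ((a • x) +ᵥ y) a x 1ℤ y
+ᵥ-lincomb a x y = pointwise λ i →
  trans (lookup-+ᵥ (a • x) y i) (trans (cong (λ s → s + lookup y i) (lookup-• a x i)) (unit a (lookup x i) (lookup y i)))
  where
  unit : ∀ a s t → a * s + t ≡ a * s + 1ℤ * t
  unit = solve-∀

-ᵥ-lincomb : (x y : Vecℤ n) → LinComb (x -ᵥ y) 1ℤ x (- 1ℤ) y
-ᵥ-lincomb x y = pointwise λ i →
  trans (lookup-+ᵥ x (-ᵥ y) i) (trans (cong (_+_ (lookup x i)) (lookup-negᵥ y i)) (unit (lookup x i) (lookup y i)))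
  where
  unit : ∀ s t → s + - t ≡ 1ℤ * s + - 1ℤ * t
  unit = solve-∀

lookup-ε-ε : (a b c : Fin n) → lookup (ε a -ᵥ ε b) c ≡ δ a c - δ b c
lookup-ε-ε a b c =
  trans (at (-ᵥ-lincomb (ε a) (ε b)) c)
        (trans (cong₂ (λ s t → 1ℤ * s + - 1ℤ * t) (lookup-ε a c) (lookup-ε b c)) (unit (δ a c) (δ b c)))
  where
  unit : ∀ s t → 1ℤ * s + - 1ℤ * t ≡ s - t
  unit = solve-∀

-ᵥ-flip : (x y : Vecℤ n) → x -ᵥ y ≡ -ᵥ (y -ᵥ x)
-ᵥ-flip x y = vec-ext λ i → begin
  lookup (x -ᵥ y) i               ≡⟨ at (-ᵥ-lincomb x y) i ⟩
  1ℤ * lookup x i + - 1ℤ * lookup y i ≡⟨ flip (lookup x i) (lookup y i) ⟩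
  - (1ℤ * lookup y i + - 1ℤ * lookup x i) ≡⟨ cong -_ (sym (at (-ᵥ-lincomb y x) i)) ⟩
  - lookup (y -ᵥ x) i             ≡⟨ sym (lookup-negᵥ (y -ᵥ x) i) ⟩
  lookup (-ᵥ (y -ᵥ x)) i          ∎
  where
  open ≡-Reasoning
  flip : ∀ s t → 1ℤ * s + - 1ℤ * t ≡ - (1ℤ * t + - 1ℤ * s)
  flip = solve-∀

-- Bilinear forms and linear maps

bform-∑ : (G : Gram n) (x y : Vecℤ n) →
  bform G x y ≡ sum (λ i → sum (λ j → lookup x i * G i j * lookup y j))
bform-∑ G x y =
  trans (sumV-tabulate (λ i → sumV (tabulate (entry i))))
        (sum-cong-≗ (λ i → sumV-tabulate (entry i)))
  where
  entry : Fin _ → Fin _ → ℤ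
  entry i j = lookup x i * G i j * lookup y j

module _ (G : Gram n) where

  bform-linearˡ : ∀ {w a x b y} (z : Vecℤ n) → LinComb w a x b y →
    bform G w z ≡ a * bform G x z + b * bform G y z
  bform-linearˡ {w} {a} {x} {b} {y} z w≡ax+by = begin
    bform G w z                                         ≡⟨ bform-∑ G w z ⟩
    sum (λ i → sum (term w i))
      ≡⟨ sum-cong-≗ (λ i → trans (sum-cong-≗ (expand i)) (∑-linear a b (term x i) (term y i))) ⟩
    sum (λ i → a * sum (term x i) + b * sum (term y i)) ≡⟨ ∑-linear a b (λ i → sum (term x i)) (λ i → sum (term y i)) ⟩
    a * sum (λ i → sum (term x i)) + b * sum (λ i → sum (term y i))
                                                        ≡⟨ sym (cong₂ (λ s t → a * s + b * t) (bform-∑ G x z) (bform-∑ G y z)) ⟩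
    a * bform G x z + b * bform G y z                   ∎
    where
    open ≡-Reasoning
    term : Vecℤ n → Fin n → Fin n → ℤ
    term u i j = lookup u i * G i j * lookup z j
    distribute : ∀ a b xi yi g zj → (a * xi + b * yi) * g * zj ≡ a * (xi * g * zj) + b * (yi * g * zj)
    distribute = solve-∀
    expand : ∀ i j → term w i j ≡ a * term x i j + b * term y i j
    expand i j rewrite at w≡ax+by i = distribute a b (lookup x i) (lookup y i) (G i j) (lookup z j)

  module _ (G-sym : ∀ i j → G i j ≡ G j i) where

    bform-sym : (x y : Vecℤ n) → bform G x y ≡ bform G y x
    bform-sym x y = begin
      bform G x y                                              ≡⟨ bform-∑ G x y ⟩
      sum (λ i → sum (λ j → lookup x i * G i j * lookup y j))  ≡⟨ ∑-comm (λ i j → lookup x i * G i j * lookup y j) ⟩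
      sum (λ j → sum (λ i → lookup x i * G i j * lookup y j))  ≡⟨ sum-cong-≗ (λ j → sum-cong-≗ (λ i → transpose i j)) ⟩
      sum (λ j → sum (λ i → lookup y j * G j i * lookup x i))  ≡⟨ sym (bform-∑ G y x) ⟩
      bform G y x                                              ∎
      where
      open ≡-Reasoning
      commute : ∀ a g b → a * g * b ≡ b * g * a
      commute = solve-∀
      transpose : ∀ i j → lookup x i * G i j * lookup y j ≡ lookup y j * G j i * lookup x i
      transpose i j rewrite G-sym i j = commute (lookup x i) (G j i) (lookup y j)

    bform-linearʳ : ∀ {w a x b y} (z : Vecℤ n) → LinComb w a x b y →
      bform G z w ≡ a * bform G z x + b * bform G z y
    bform-linearʳ {w} {a} {x} {b} {y} z w≡ax+by =
      trans (bform-sym z w)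
        (trans (bform-linearˡ z w≡ax+by) (cong₂ (λ s t → a * s + b * t) (bform-sym x z) (bform-sym y z)))

  bform-ε : (i j : Fin n) → bform G (ε i) (ε j) ≡ G i j
  bform-ε i j = begin
    bform G (ε i) (ε j)                                         ≡⟨ bform-∑ G (ε i) (ε j) ⟩
    sum (λ a → sum (λ b → lookup (ε i) a * G a b * lookup (ε j) b))
      ≡⟨ sum-cong-≗ (λ a → sum-cong-≗ (λ b → cong₂ (λ s t → s * G a b * t) (lookup-ε i a) (lookup-ε j b))) ⟩
    sum (λ a → sum (λ b → δ i a * G a b * δ j b))             ≡⟨ sum-cong-≗ (λ a → ∑-δʳ j (λ b → δ i a * G a b)) ⟩
    sum (λ a → δ i a * G a j)                                   ≡⟨ ∑-δ i (λ a → G a j) ⟩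
    G i j                                                       ∎
    where open ≡-Reasoning

bform-cong : {G G′ : Gram n} → (∀ i j → G i j ≡ G′ i j) → ∀ x y → bform G x y ≡ bform G′ x y
bform-cong {G = G} {G′} G≡G′ x y =
  trans (bform-∑ G x y)
    (trans (sum-cong-≗ (λ i → sum-cong-≗ (λ j → cong (λ g → lookup x i * g * lookup y j) (G≡G′ i j))))
           (sym (bform-∑ G′ x y)))

IsLinear : (Vecℤ n → Vecℤ k) → Set
IsLinear h = ∀ {w a x b y} → LinComb w a x b y → LinComb (h w) a (h x) b (h y)

id-linear : IsLinear {n} (λ x → x)
id-linear w≡ax+by = w≡ax+by

∘-linear : {h : Vecℤ k → Vecℤ n} {g : Vecℤ m → Vecℤ k} → IsLinear h → IsLinear g → IsLinear (h ∘ g)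
∘-linear h-linear g-linear = h-linear ∘ g-linear

linear-zeroV : {h : Vecℤ n → Vecℤ k} → IsLinear h → h zeroV ≡ zeroV
linear-zeroV {h = h} h-linear = vec-ext λ i →
  trans (at (h-linear zeroV-lincomb) i) (trans (annihilate (lookup (h zeroV) i)) (sym (lookup-zeroV i)))
  where
  annihilate : ∀ t → 0ℤ * t + 0ℤ * t ≡ 0ℤ
  annihilate = solve-∀

linear-subᵥ : {h : Vecℤ n → Vecℤ k} → IsLinear h → ∀ x y → h (x -ᵥ y) ≡ h x -ᵥ h y
linear-subᵥ {h = h} h-linear x y = vec-ext λ i →
  trans (at (h-linear (-ᵥ-lincomb x y)) i) (sym (at (-ᵥ-lincomb (h x) (h y)) i))

-- Definitionally equal to apply from Defs, which is the same map with the lattice as an index.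
lincomb : Vec (Vecℤ n) m → Vecℤ m → Vecℤ n
lincomb f x = foldr _ _+ᵥ_ zeroV (zipWith _•_ x f)

lookup-lincomb : (f : Vec (Vecℤ n) m) (x : Vecℤ m) (j : Fin n) →
  lookup (lincomb f x) j ≡ sum (λ i → lookup x i * lookup (lookup f i) j)
lookup-lincomb []      []      j = lookup-zeroV j
lookup-lincomb (u ∷ f) (a ∷ x) j =
  trans (lookup-+ᵥ (a • u) (lincomb f x) j) (cong₂ _+_ (lookup-• a u j) (lookup-lincomb f x j))

lincomb-linear : (f : Vec (Vecℤ n) m) → IsLinear (lincomb f)
lincomb-linear f {w} {a} {x} {b} {y} w≡ax+by = pointwise λ j → begin
  lookup (lincomb f w) j                         ≡⟨ lookup-lincomb f w j ⟩
  sum (λ i → lookup w i * coeff i j)             ≡⟨ sum-cong-≗ (λ i → expand i j) ⟩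
  sum (λ i → a * (lookup x i * coeff i j) + b * (lookup y i * coeff i j))
                                                 ≡⟨ ∑-linear a b (λ i → lookup x i * coeff i j) (λ i → lookup y i * coeff i j) ⟩
  a * sum (λ i → lookup x i * coeff i j) + b * sum (λ i → lookup y i * coeff i j)
                                                 ≡⟨ sym (cong₂ (λ s t → a * s + b * t) (lookup-lincomb f x j) (lookup-lincomb f y j)) ⟩
  a * lookup (lincomb f x) j + b * lookup (lincomb f y) j ∎
  where
  open ≡-Reasoning
  coeff : Fin _ → Fin _ → ℤ
  coeff i j = lookup (lookup f i) j
  distribute : ∀ a b xi yi c → (a * xi + b * yi) * c ≡ a * (xi * c) + b * (yi * c)
  distribute = solve-∀
  expand : ∀ i j → lookup w i * coeff i j ≡ a * (lookup x i * coeff i j) + b * (lookup y i * coeff i j)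
  expand i j rewrite at w≡ax+by i = distribute a b (lookup x i) (lookup y i) (coeff i j)

linear-lincomb : {h : Vecℤ n → Vecℤ k} → IsLinear h →
  (f : Vec (Vecℤ n) m) (x : Vecℤ m) → h (lincomb f x) ≡ lincomb (map h f) x
linear-lincomb h-linear []      []      = linear-zeroV h-linear
linear-lincomb {h = h} h-linear (u ∷ f) (a ∷ x) = vec-ext λ j → begin
  lookup (h ((a • u) +ᵥ lincomb f x)) j                    ≡⟨ at (h-linear (+ᵥ-lincomb a u (lincomb f x))) j ⟩
  a * lookup (h u) j + 1ℤ * lookup (h (lincomb f x)) j
    ≡⟨ cong (λ v → a * lookup (h u) j + 1ℤ * lookup v j) (linear-lincomb h-linear f x) ⟩
  a * lookup (h u) j + 1ℤ * lookup (lincomb (map h f) x) j ≡⟨ sym (at (+ᵥ-lincomb a (h u) (lincomb (map h f) x)) j) ⟩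
  lookup ((a • h u) +ᵥ lincomb (map h f) x) j               ∎
  where open ≡-Reasoning

lincomb-εs : (x : Vecℤ n) → lincomb (tabulate ε) x ≡ x
lincomb-εs x = vec-ext λ j → begin
  lookup (lincomb (tabulate ε) x) j                   ≡⟨ lookup-lincomb (tabulate ε) x j ⟩
  sum (λ i → lookup x i * lookup (lookup (tabulate ε) i) j)
    ≡⟨ sum-cong-≗ (λ i → cong (λ v → lookup x i * lookup v j) (lookup∘tabulate ε i)) ⟩
  sum (λ i → lookup x i * lookup (ε i) j)             ≡⟨ sum-cong-≗ (λ i → cong (lookup x i *_) (trans (lookup-ε i j) (δ-sym i j))) ⟩
  sum (λ i → lookup x i * δ j i)                      ≡⟨ ∑-δʳ j (lookup x) ⟩
  lookup x j                                          ∎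
  where open ≡-Reasoning

linear-ext : {h h′ : Vecℤ n → Vecℤ k} → IsLinear h → IsLinear h′ →
  (∀ i → h (ε i) ≡ h′ (ε i)) → ∀ x → h x ≡ h′ x
linear-ext {h = h} {h′} h-linear h′-linear agree x = begin
  h x                              ≡⟨ cong h (sym (lincomb-εs x)) ⟩
  h (lincomb (tabulate ε) x)       ≡⟨ linear-lincomb h-linear (tabulate ε) x ⟩
  lincomb (map h (tabulate ε)) x   ≡⟨ cong (λ f → lincomb f x) images≡ ⟩
  lincomb (map h′ (tabulate ε)) x  ≡⟨ sym (linear-lincomb h′-linear (tabulate ε) x) ⟩
  h′ (lincomb (tabulate ε) x)      ≡⟨ cong h′ (lincomb-εs x) ⟩
  h′ x                             ∎
  where
  open ≡-Reasoning
  images≡ : map h (tabulate ε) ≡ map h′ (tabulate ε)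
  images≡ = trans (sym (tabulate-∘ h ε)) (trans (tabulate-cong agree) (tabulate-∘ h′ ε))

module _ (G : Gram n) where

  bform-lincombˡ : (f : Vec (Vecℤ n) m) (x : Vecℤ m) (y : Vecℤ n) →
    bform G (lincomb f x) y ≡ sum (λ i → lookup x i * bform G (lookup f i) y)
  bform-lincombˡ []      []      y = trans (bform-linearˡ G y zeroV-lincomb) (annihilate (bform G zeroV y))
    where
    annihilate : ∀ t → 0ℤ * t + 0ℤ * t ≡ 0ℤ
    annihilate = solve-∀
  bform-lincombˡ (u ∷ f) (a ∷ x) y =
    trans (bform-linearˡ G y (+ᵥ-lincomb a u (lincomb f x)))
          (cong (_+_ (a * bform G u y)) (trans (ℤₚ.*-identityˡ _) (bform-lincombˡ f x y)))

  gramOf : Vec (Vecℤ n) m → Gram m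
  gramOf f i j = bform G (lookup f i) (lookup f j)

  bform-lincomb : (∀ i j → G i j ≡ G j i) → (f : Vec (Vecℤ n) m) (x y : Vecℤ m) →
    bform G (lincomb f x) (lincomb f y) ≡ bform (gramOf f) x y
  bform-lincomb G-sym f x y = begin
    bform G (lincomb f x) (lincomb f y)
      ≡⟨ bform-lincombˡ f x (lincomb f y) ⟩
    sum (λ i → lookup x i * bform G (lookup f i) (lincomb f y))
      ≡⟨ sum-cong-≗ (λ i → cong (lookup x i *_)
           (trans (bform-sym G G-sym (lookup f i) (lincomb f y)) (bform-lincombˡ f y (lookup f i)))) ⟩
    sum (λ i → lookup x i * sum (λ j → lookup y j * bform G (lookup f j) (lookup f i)))
      ≡⟨ sum-cong-≗ (λ i → trans (*-distribˡ-sum (lookup x i) (λ j → lookup y j * bform G (lookup f j) (lookup f i)))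
                                 (sum-cong-≗ (reorder i))) ⟩
    sum (λ i → sum (λ j → lookup x i * gramOf f i j * lookup y j))
      ≡⟨ sym (bform-∑ (gramOf f) x y) ⟩
    bform (gramOf f) x y ∎
    where
    open ≡-Reasoning
    shuffle : ∀ a b g → a * (b * g) ≡ a * g * b
    shuffle = solve-∀
    reorder : ∀ i j → lookup x i * (lookup y j * bform G (lookup f j) (lookup f i)) ≡ lookup x i * gramOf f i j * lookup y j
    reorder i j = trans (cong (λ g → lookup x i * (lookup y j * g)) (bform-sym G G-sym (lookup f j) (lookup f i)))
                        (shuffle (lookup x i) (lookup y j) (gramOf f i j))

signed : Bool → Vecℤ n → Vecℤ n
signed false x = x
signed true  x = -ᵥ x

signed-involutive : ∀ b (x : Vecℤ n) → signed b (signed b x) ≡ x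
signed-involutive false x = refl
signed-involutive true  x = vec-ext λ i →
  trans (lookup-negᵥ (-ᵥ x) i) (trans (cong -_ (lookup-negᵥ x i)) (ℤₚ.neg-involutive (lookup x i)))

signed-linear : ∀ b → IsLinear {n} (signed b)
signed-linear false = id-linear
signed-linear true {w} {a} {x} {b} {y} w≡ax+by = pointwise λ i → begin
  lookup (-ᵥ w) i                       ≡⟨ lookup-negᵥ w i ⟩
  - lookup w i                          ≡⟨ cong -_ (at w≡ax+by i) ⟩
  - (a * lookup x i + b * lookup y i)   ≡⟨ negate a b (lookup x i) (lookup y i) ⟩
  a * - lookup x i + b * - lookup y i   ≡⟨ sym (cong₂ (λ s t → a * s + b * t) (lookup-negᵥ x i) (lookup-negᵥ y i)) ⟩
  a * lookup (-ᵥ x) i + b * lookup (-ᵥ y) i ∎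
  where
  open ≡-Reasoning
  negate : ∀ a b s t → - (a * s + b * t) ≡ a * - s + b * - t
  negate = solve-∀

linear-signed : {h : Vecℤ n → Vecℤ k} → IsLinear h → ∀ b x → h (signed b x) ≡ signed b (h x)
linear-signed h-linear false x = refl
linear-signed {h = h} h-linear true x = vec-ext λ i →
  trans (at (h-linear negation) i) (trans (negate (lookup (h x) i)) (sym (lookup-negᵥ (h x) i)))
  where
  negate : ∀ t → - 1ℤ * t + 0ℤ * t ≡ - t
  negate = solve-∀
  negation : LinComb (-ᵥ x) (- 1ℤ) x 0ℤ x
  negation = pointwise λ i → trans (lookup-negᵥ x i) (sym (negate (lookup x i)))

-- Reflections

-- reflect U = reflectG (gram U) definitionally.
reflectG : Gram n → Vecℤ n → Vecℤ n → Vecℤ n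
reflectG G α x = x -ᵥ (bform G x α • α)

module _ (G : Gram n) (α : Vecℤ n) where

  reflectG-lincomb : (x : Vecℤ n) → LinComb (reflectG G α x) 1ℤ x (- bform G x α) α
  reflectG-lincomb x = pointwise λ i → begin
    lookup (reflectG G α x) i                         ≡⟨ lookup-+ᵥ x (-ᵥ (c • α)) i ⟩
    lookup x i + lookup (-ᵥ (c • α)) i
      ≡⟨ cong (_+_ (lookup x i)) (trans (lookup-negᵥ (c • α) i) (cong -_ (lookup-• c α i))) ⟩
    lookup x i + - (c * lookup α i)                   ≡⟨ rearrange (lookup x i) c (lookup α i) ⟩
    1ℤ * lookup x i + - c * lookup α i                ∎
    where
    open ≡-Reasoning
    c = bform G x α
    rearrange : ∀ s c t → s + - (c * t) ≡ 1ℤ * s + - c * t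
    rearrange = solve-∀

  reflectG-linear : IsLinear (reflectG G α)
  reflectG-linear {w} {a} {x} {b} {y} w≡ax+by = pointwise λ i → begin
    lookup (reflectG G α w) i                          ≡⟨ at (reflectG-lincomb w) i ⟩
    1ℤ * lookup w i + - bform G w α * lookup α i
      ≡⟨ cong₂ (λ s t → 1ℤ * s + - t * lookup α i) (at w≡ax+by i) (bform-linearˡ G α w≡ax+by) ⟩
    1ℤ * (a * lookup x i + b * lookup y i) + - (a * bform G x α + b * bform G y α) * lookup α i
      ≡⟨ regroup a b (lookup x i) (lookup y i) (bform G x α) (bform G y α) (lookup α i) ⟩
    a * (1ℤ * lookup x i + - bform G x α * lookup α i) + b * (1ℤ * lookup y i + - bform G y α * lookup α i)
      ≡⟨ sym (cong₂ (λ s t → a * s + b * t) (at (reflectG-lincomb x) i) (at (reflectG-lincomb y) i)) ⟩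
    a * lookup (reflectG G α x) i + b * lookup (reflectG G α y) i ∎
    where
    open ≡-Reasoning
    regroup : ∀ a b xi yi cx cy αi →
      1ℤ * (a * xi + b * yi) + - (a * cx + b * cy) * αi ≡ a * (1ℤ * xi + - cx * αi) + b * (1ℤ * yi + - cy * αi)
    regroup = solve-∀

  reflectG-isometry : (∀ i j → G i j ≡ G j i) → bform G α α ≡ + 2 →
    (x y : Vecℤ n) → bform G (reflectG G α x) (reflectG G α y) ≡ bform G x y
  reflectG-isometry G-sym α²≡2 x y = begin
    bform G (reflectG G α x) (reflectG G α y)
      ≡⟨ bform-linearˡ G (reflectG G α y) (reflectG-lincomb x) ⟩
    1ℤ * bform G x (reflectG G α y) + - cx * bform G α (reflectG G α y)
      ≡⟨ cong₂ (λ s t → 1ℤ * s + - cx * t)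
               (bform-linearʳ G G-sym x (reflectG-lincomb y)) (bform-linearʳ G G-sym α (reflectG-lincomb y)) ⟩
    1ℤ * (1ℤ * bform G x y + - cy * cx) + - cx * (1ℤ * bform G α y + - cy * bform G α α)
      ≡⟨ cong₂ (λ s t → 1ℤ * (1ℤ * bform G x y + - cy * cx) + - cx * (1ℤ * s + - cy * t)) (bform-sym G G-sym α y) α²≡2 ⟩
    1ℤ * (1ℤ * bform G x y + - cy * cx) + - cx * (1ℤ * cy + - cy * + 2)
      ≡⟨ cancel (bform G x y) cx cy ⟩
    bform G x y ∎
    where
    open ≡-Reasoning
    cx = bform G x α
    cy = bform G y α
    cancel : ∀ b cx cy → 1ℤ * (1ℤ * b + - cy * cx) + - cx * (1ℤ * cy + - cy * + 2) ≡ b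
    cancel = solve-∀

isometry-reflectG : {G : Gram n} {G′ : Gram k} {h : Vecℤ n → Vecℤ k} → IsLinear h →
  (∀ x y → bform G′ (h x) (h y) ≡ bform G x y) →
  ∀ α x → h (reflectG G α x) ≡ reflectG G′ (h α) (h x)
isometry-reflectG {G = G} {G′} {h} h-linear h-isometry α x = vec-ext λ i → begin
  lookup (h (reflectG G α x)) i                     ≡⟨ at (h-linear (reflectG-lincomb G α x)) i ⟩
  1ℤ * lookup (h x) i + - bform G x α * lookup (h α) i
    ≡⟨ cong (λ c → 1ℤ * lookup (h x) i + - c * lookup (h α) i) (sym (h-isometry x α)) ⟩
  1ℤ * lookup (h x) i + - bform G′ (h x) (h α) * lookup (h α) i ≡⟨ sym (at (reflectG-lincomb G′ (h α) (h x)) i) ⟩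
  lookup (reflectG G′ (h α) (h x)) i                ∎
  where open ≡-Reasoning

reflections : Gram n → List (Vecℤ n) → Vecℤ n → Vecℤ n
reflections G List.[]       x = x
reflections G (α List.∷ αs) x = reflectG G α (reflections G αs x)

reflections-linear : (G : Gram n) (αs : List (Vecℤ n)) → IsLinear (reflections G αs)
reflections-linear G List.[]       = id-linear
reflections-linear G (α List.∷ αs) = ∘-linear (reflectG-linear G α) (reflections-linear G αs)


-- Roots and transpositions of ℤ^n

dot : Vecℤ n → Vecℤ n → ℤ
dot = bform δ

dot-∑ : (x y : Vecℤ n) → dot x y ≡ sum (λ i → lookup x i * lookup y i)
dot-∑ x y = trans (bform-∑ δ x y) (sum-cong-≗ λ i →
  trans (sum-cong-≗ (λ j → shuffle (lookup x i) (δ i j) (lookup y j))) (∑-δ i (λ j → lookup x i * lookup y j)))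
  where
  shuffle : ∀ a d b → a * d * b ≡ d * (a * b)
  shuffle = solve-∀

rootDot : Fin n → Fin n → Fin n → Fin n → ℤ
rootDot a b c d = δ a c - δ a d - δ b c + δ b d

dot-ε-ε : (a b c d : Fin n) → dot (ε a -ᵥ ε b) (ε c -ᵥ ε d) ≡ rootDot a b c d
dot-ε-ε a b c d = begin
  dot (ε a -ᵥ ε b) (ε c -ᵥ ε d)
    ≡⟨ bform-linearˡ δ (ε c -ᵥ ε d) (-ᵥ-lincomb (ε a) (ε b)) ⟩
  1ℤ * dot (ε a) (ε c -ᵥ ε d) + - 1ℤ * dot (ε b) (ε c -ᵥ ε d)
    ≡⟨ cong₂ combine (bform-linearʳ δ δ-sym (ε a) (-ᵥ-lincomb (ε c) (ε d)))
                     (bform-linearʳ δ δ-sym (ε b) (-ᵥ-lincomb (ε c) (ε d))) ⟩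
  1ℤ * (1ℤ * dot (ε a) (ε c) + - 1ℤ * dot (ε a) (ε d)) + - 1ℤ * (1ℤ * dot (ε b) (ε c) + - 1ℤ * dot (ε b) (ε d))
    ≡⟨ cong₂ combine (cong₂ combine (bform-ε δ a c) (bform-ε δ a d)) (cong₂ combine (bform-ε δ b c) (bform-ε δ b d)) ⟩
  1ℤ * (1ℤ * δ a c + - 1ℤ * δ a d) + - 1ℤ * (1ℤ * δ b c + - 1ℤ * δ b d)
    ≡⟨ expand (δ a c) (δ a d) (δ b c) (δ b d) ⟩
  rootDot a b c d ∎
  where
  open ≡-Reasoning
  combine : ℤ → ℤ → ℤ
  combine s t = 1ℤ * s + - 1ℤ * t
  expand : ∀ ac ad bc bd → 1ℤ * (1ℤ * ac + - 1ℤ * ad) + - 1ℤ * (1ℤ * bc + - 1ℤ * bd) ≡ ac - ad - bc + bd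
  expand = solve-∀

normℕ : Vecℤ n → ℕ
normℕ []      = 0
normℕ (h ∷ y) = ∣ h ∣ ℕ.* ∣ h ∣ ℕ.+ normℕ y

dot-normℕ : (y : Vecℤ n) → dot y y ≡ + normℕ y
dot-normℕ y = trans (dot-∑ y y) (squares y)
  where
  square : ∀ h → h * h ≡ + (∣ h ∣ ℕ.* ∣ h ∣)
  square (+ zero)  = refl
  square (+ suc _) = refl
  square -[1+ _ ]  = refl
  squares : (y : Vecℤ k) → sum (λ i → lookup y i * lookup y i) ≡ + normℕ y
  squares []      = refl
  squares (h ∷ y) = cong₂ _+_ (square h) (squares y)

square+r≢ : ∀ n r {k} → k ≤ 2 → suc (suc n) ℕ.* suc (suc n) ℕ.+ r ≢ k
square+r≢ n r k≤2 refl = 4≰2 (ℕₚ.≤-trans (ℕₚ.≤-trans 4≤square (ℕₚ.m≤m+n _ r)) k≤2)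
  where
  4≤square : 4 ≤ suc (suc n) ℕ.* suc (suc n)
  4≤square = ℕₚ.*-mono-≤ {2} {suc (suc n)} {2} {suc (suc n)} (ℕ.s≤s (ℕ.s≤s ℕ.z≤n)) (ℕ.s≤s (ℕ.s≤s ℕ.z≤n))
  4≰2 : ¬ (4 ≤ 2)
  4≰2 (ℕ.s≤s (ℕ.s≤s ()))

IsUnit : ℤ → Set
IsUnit s = s ≡ 1ℤ ⊎ s ≡ -1ℤ

IsUnitVector : Vecℤ n → Set
IsUnitVector {n} y = Σ[ a ∈ Fin n ] Σ[ s ∈ ℤ ] IsUnit s × (∀ c → lookup y c ≡ s * δ a c)

IsUnitPair : Vecℤ n → Set
IsUnitPair {n} y = Σ[ a ∈ Fin n ] Σ[ b ∈ Fin n ] Σ[ s ∈ ℤ ] Σ[ t ∈ ℤ ]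
  a ≢ b × IsUnit s × IsUnit t × (∀ c → lookup y c ≡ s * δ a c + t * δ b c)

zero∷-unitVector : {y : Vecℤ n} → IsUnitVector y → IsUnitVector (0ℤ ∷ y)
zero∷-unitVector (a , s , s-unit , y≡sε) = suc a , s , s-unit , λ where
  zero    → sym (ℤₚ.*-zeroʳ s)
  (suc c) → y≡sε c

unit∷-unitVector : {s : ℤ} {y : Vecℤ n} → IsUnit s → (∀ c → lookup y c ≡ 0ℤ) → IsUnitVector (s ∷ y)
unit∷-unitVector {s = s} s-unit y≡0 = zero , s , s-unit , λ where
  zero    → sym (ℤₚ.*-identityʳ s)
  (suc c) → trans (y≡0 c) (sym (ℤₚ.*-zeroʳ s))

zero∷-unitPair : {y : Vecℤ n} → IsUnitPair y → IsUnitPair (0ℤ ∷ y)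
zero∷-unitPair (a , b , s , t , a≢b , s-unit , t-unit , y≡sε+tε) =
  suc a , suc b , s , t , a≢b ∘ Finₚ.suc-injective , s-unit , t-unit , λ where
    zero    → vanish s t
    (suc c) → y≡sε+tε c
  where
  vanish : ∀ s t → 0ℤ ≡ s * 0ℤ + t * 0ℤ
  vanish = solve-∀

unit∷-unitPair : {s : ℤ} {y : Vecℤ n} → IsUnit s → IsUnitVector y → IsUnitPair (s ∷ y)
unit∷-unitPair {s = s} s-unit (a , t , t-unit , y≡tε) = zero , suc a , s , t , (λ ()) , s-unit , t-unit , λ where
    zero    → head s t
    (suc c) → trans (y≡tε c) (tail s t (δ a c))
  where
  head : ∀ s t → s ≡ s * 1ℤ + t * 0ℤ
  head = solve-∀
  tail : ∀ s t d → t * d ≡ s * 0ℤ + t * d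
  tail = solve-∀

normℕ≡0 : (y : Vecℤ n) → normℕ y ≡ 0 → ∀ c → lookup y c ≡ 0ℤ
normℕ≡0 (+ zero ∷ y) ‖y‖≡0 zero    = refl
normℕ≡0 (+ zero ∷ y) ‖y‖≡0 (suc c) = normℕ≡0 y ‖y‖≡0 c

normℕ≡1 : (y : Vecℤ n) → normℕ y ≡ 1 → IsUnitVector y
normℕ≡1 (+ zero ∷ y)        ‖y‖≡1 = zero∷-unitVector (normℕ≡1 y ‖y‖≡1)
normℕ≡1 (+ suc zero ∷ y)    ‖y‖≡1 = unit∷-unitVector (inj₁ refl) (normℕ≡0 y (ℕₚ.suc-injective ‖y‖≡1))
normℕ≡1 (-[1+ zero ] ∷ y)   ‖y‖≡1 = unit∷-unitVector (inj₂ refl) (normℕ≡0 y (ℕₚ.suc-injective ‖y‖≡1))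
normℕ≡1 (+ suc (suc n) ∷ y) ‖y‖≡1 = ⊥-elim (square+r≢ n (normℕ y) (ℕ.s≤s ℕ.z≤n) ‖y‖≡1)
normℕ≡1 (-[1+ suc n ] ∷ y)  ‖y‖≡1 = ⊥-elim (square+r≢ n (normℕ y) (ℕ.s≤s ℕ.z≤n) ‖y‖≡1)

normℕ≡2 : (y : Vecℤ n) → normℕ y ≡ 2 → IsUnitPair y
normℕ≡2 (+ zero ∷ y)        ‖y‖≡2 = zero∷-unitPair (normℕ≡2 y ‖y‖≡2)
normℕ≡2 (+ suc zero ∷ y)    ‖y‖≡2 = unit∷-unitPair (inj₁ refl) (normℕ≡1 y (ℕₚ.suc-injective ‖y‖≡2))
normℕ≡2 (-[1+ zero ] ∷ y)   ‖y‖≡2 = unit∷-unitPair (inj₂ refl) (normℕ≡1 y (ℕₚ.suc-injective ‖y‖≡2))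
normℕ≡2 (+ suc (suc n) ∷ y) ‖y‖≡2 = ⊥-elim (square+r≢ n (normℕ y) ℕₚ.≤-refl ‖y‖≡2)
normℕ≡2 (-[1+ suc n ] ∷ y)  ‖y‖≡2 = ⊥-elim (square+r≢ n (normℕ y) ℕₚ.≤-refl ‖y‖≡2)

IsεDifference : Vecℤ n → Set
IsεDifference {n} y = Σ[ a ∈ Fin n ] Σ[ b ∈ Fin n ] a ≢ b × y ≡ ε a -ᵥ ε b

root-ε-ε : (y : Vecℤ n) → sumV y ≡ 0ℤ → dot y y ≡ + 2 → IsεDifference y
root-ε-ε y Σy≡0 y²≡2 with normℕ≡2 y (ℤₚ.+-injective (trans (sym (dot-normℕ y)) y²≡2))
... | a , b , s , t , a≢b , s-unit , t-unit , y≡sε+tε = orient s-unit t-unit s+t≡0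
  where
  s+t≡0 : s + t ≡ 0ℤ
  s+t≡0 = begin
    s + t                                  ≡⟨ sym (cong₂ _+_ (ℤₚ.*-identityʳ s) (ℤₚ.*-identityʳ t)) ⟩
    s * 1ℤ + t * 1ℤ                        ≡⟨ sym (cong₂ (λ u v → s * u + t * v) (∑-δ≡1 a) (∑-δ≡1 b)) ⟩
    s * sum (δ a) + t * sum (δ b)          ≡⟨ sym (∑-linear s t (δ a) (δ b)) ⟩
    sum (λ c → s * δ a c + t * δ b c)      ≡⟨ sum-cong-≗ (λ c → sym (y≡sε+tε c)) ⟩
    sum (lookup y)                         ≡⟨ sym (sumV-∑ y) ⟩
    sumV y                                 ≡⟨ Σy≡0 ⟩
    0ℤ                                     ∎
    where open ≡-Reasoning
  orient : IsUnit s → IsUnit t → s + t ≡ 0ℤ → IsεDifference y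
  orient (inj₁ refl) (inj₁ refl) ()
  orient (inj₂ refl) (inj₂ refl) ()
  orient (inj₁ refl) (inj₂ refl) _ = a , b , a≢b , vec-ext λ c →
    trans (y≡sε+tε c) (trans (difference (δ a c) (δ b c)) (sym (lookup-ε-ε a b c)))
    where
    difference : ∀ u v → 1ℤ * u + -1ℤ * v ≡ u - v
    difference = solve-∀
  orient (inj₂ refl) (inj₁ refl) _ = b , a , a≢b ∘ sym , vec-ext λ c →
    trans (y≡sε+tε c) (trans (difference (δ a c) (δ b c)) (sym (lookup-ε-ε b a c)))
    where
    difference : ∀ u v → -1ℤ * u + 1ℤ * v ≡ v - u
    difference = solve-∀

transpose-j : (i j : Fin n) → PC.transpose i j j ≡ i
transpose-j i j with j Fin.≟ i
... | yes j≡i = j≡i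
... | no _ with j Fin.≟ j
...   | yes _   = refl
...   | no j≢j = ⊥-elim (j≢j refl)

transpose-injective : (i j : Fin n) → Injective _≡_ _≡_ (PC.transpose i j)
transpose-injective i j {x} {y} τx≡τy =
  trans (sym (PC.transpose-inverse j i)) (trans (cong (PC.transpose j i) τx≡τy) (PC.transpose-inverse j i))

Transposition : ℕ → Set
Transposition n = Σ[ ij ∈ Fin n × Fin n ] proj₁ ij ≢ proj₂ ij

permuteBy : List (Transposition n) → Fin n → Fin n
permuteBy List.[]                     k = k
permuteBy (((i , j) , _) List.∷ τs) k = PC.transpose i j (permuteBy τs k)

permuteBy-++ : (τs σs : List (Transposition n)) (k : Fin n) → permuteBy (τs List.++ σs) k ≡ permuteBy τs (permuteBy σs k)
permuteBy-++ List.[]                     σs k = refl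
permuteBy-++ (((i , j) , _) List.∷ τs) σs k = cong (PC.transpose i j) (permuteBy-++ τs σs k)

permuteBy-injective : (τs : List (Transposition n)) → Injective _≡_ _≡_ (permuteBy τs)
permuteBy-injective List.[]                     eq = eq
permuteBy-injective (((i , j) , _) List.∷ τs) eq = permuteBy-injective τs (transpose-injective i j eq)

liftTransposition : Transposition n → Transposition (suc n)
liftTransposition ((i , j) , i≢j) = (suc i , suc j) , i≢j ∘ Finₚ.suc-injective

permuteBy-lift-zero : (τs : List (Transposition n)) → permuteBy (List.map liftTransposition τs) zero ≡ zero
permuteBy-lift-zero List.[]                     = refl
permuteBy-lift-zero (((i , j) , _) List.∷ τs) =
  trans (cong (PC.transpose (suc i) (suc j)) (permuteBy-lift-zero τs)) (lift₀-transpose i j zero)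

permuteBy-lift-suc : (τs : List (Transposition n)) (k : Fin n) →
  permuteBy (List.map liftTransposition τs) (suc k) ≡ suc (permuteBy τs k)
permuteBy-lift-suc List.[]                     k = refl
permuteBy-lift-suc (((i , j) , _) List.∷ τs) k =
  trans (cong (PC.transpose (suc i) (suc j)) (permuteBy-lift-suc τs k)) (lift₀-transpose i j (suc (permuteBy τs k)))

toZero : Fin (suc n) → List (Transposition (suc n))
toZero zero    = List.[]
toZero (suc c) = ((zero , suc c) , λ ()) List.∷ List.[]

permuteBy-toZero : (c : Fin (suc n)) → permuteBy (toZero c) c ≡ zero
permuteBy-toZero zero    = refl
permuteBy-toZero (suc c) = transpose-j zero (suc c)

sortingTranspositions : (p : Fin n → Fin n) → Injective _≡_ _≡_ p →
  Σ[ τs ∈ List (Transposition n) ] ∀ i → permuteBy τs (p i) ≡ i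
sortingTranspositions {zero}  p p-injective = List.[] , λ ()
sortingTranspositions {suc n} p p-injective = List.map liftTransposition τs′ List.++ τs₀ , sorted
  where
  τs₀ = toZero (p zero)
  q : Fin (suc n) → Fin (suc n)
  q i = permuteBy τs₀ (p i)
  q-injective : Injective _≡_ _≡_ q
  q-injective = p-injective ∘ permuteBy-injective τs₀
  q-zero : q zero ≡ zero
  q-zero = permuteBy-toZero (p zero)
  zero≢q-suc : ∀ i → zero ≢ q (suc i)
  zero≢q-suc i 0≡q = 0≢1+n (q-injective (trans q-zero 0≡q))
    where
    0≢1+n : zero ≢ suc i
    0≢1+n ()
  p′ : Fin n → Fin n
  p′ i = Fin.punchOut (zero≢q-suc i)
  p′-injective : Injective _≡_ _≡_ p′
  p′-injective eq = Finₚ.suc-injective (q-injective (Finₚ.punchOut-injective (zero≢q-suc _) (zero≢q-suc _) eq))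
  recursion = sortingTranspositions p′ p′-injective
  τs′ = proj₁ recursion
  sorted : ∀ i → permuteBy (List.map liftTransposition τs′ List.++ τs₀) (p i) ≡ i
  sorted i = trans (permuteBy-++ (List.map liftTransposition τs′) τs₀ (p i)) (lifted i)
    where
    lifted : ∀ i → permuteBy (List.map liftTransposition τs′) (q i) ≡ i
    lifted zero    = trans (cong (permuteBy (List.map liftTransposition τs′)) q-zero) (permuteBy-lift-zero τs′)
    lifted (suc i) = begin
      permuteBy (List.map liftTransposition τs′) (q (suc i))
        ≡⟨ cong (permuteBy (List.map liftTransposition τs′)) (sym (Finₚ.punchIn-punchOut (zero≢q-suc i))) ⟩
      permuteBy (List.map liftTransposition τs′) (suc (p′ i))   ≡⟨ permuteBy-lift-suc τs′ (p′ i) ⟩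
      suc (permuteBy τs′ (p′ i))                                ≡⟨ cong suc (proj₂ recursion i) ⟩
      suc i                                                     ∎
      where open ≡-Reasoning

rootOf : Transposition n → Vecℤ n
rootOf ((i , j) , _) = ε i -ᵥ ε j

reflect-ε : (i j : Fin n) → i ≢ j → (k : Fin n) → reflectG δ (ε i -ᵥ ε j) (ε k) ≡ ε (PC.transpose i j k)
reflect-ε i j i≢j k = vec-ext λ c → trans (lookup-reflect c) (swapped c)
  where
  open ≡-Reasoning
  εk·α : dot (ε k) (ε i -ᵥ ε j) ≡ δ k i - δ k j
  εk·α = trans (bform-linearʳ δ δ-sym (ε k) (-ᵥ-lincomb (ε i) (ε j)))
           (trans (cong₂ (λ s t → 1ℤ * s + - 1ℤ * t) (bform-ε δ k i) (bform-ε δ k j)) (unit (δ k i) (δ k j)))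
    where
    unit : ∀ s t → 1ℤ * s + - 1ℤ * t ≡ s - t
    unit = solve-∀
  lookup-reflect : ∀ c → lookup (reflectG δ (ε i -ᵥ ε j) (ε k)) c ≡ δ k c - (δ k i - δ k j) * (δ i c - δ j c)
  lookup-reflect c = begin
    lookup (reflectG δ (ε i -ᵥ ε j) (ε k)) c
      ≡⟨ at (reflectG-lincomb δ (ε i -ᵥ ε j) (ε k)) c ⟩
    1ℤ * lookup (ε k) c + - dot (ε k) (ε i -ᵥ ε j) * lookup (ε i -ᵥ ε j) c
      ≡⟨ cong₂ (λ s t → 1ℤ * lookup (ε k) c + - s * t) εk·α (lookup-ε-ε i j c) ⟩
    1ℤ * lookup (ε k) c + - (δ k i - δ k j) * (δ i c - δ j c)
      ≡⟨ cong (λ s → 1ℤ * s + - (δ k i - δ k j) * (δ i c - δ j c)) (lookup-ε k c) ⟩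
    1ℤ * δ k c + - (δ k i - δ k j) * (δ i c - δ j c)
      ≡⟨ unit (δ k c) (δ k i - δ k j) (δ i c - δ j c) ⟩
    δ k c - (δ k i - δ k j) * (δ i c - δ j c) ∎
    where
    unit : ∀ a b d → 1ℤ * a + - b * d ≡ a - b * d
    unit = solve-∀
  swapped : ∀ c → δ k c - (δ k i - δ k j) * (δ i c - δ j c) ≡ lookup (ε (PC.transpose i j k)) c
  swapped c with k Fin.≟ i
  ... | yes refl rewrite δ-refl k | δ-≢ i≢j = trans (to-j (δ k c) (δ j c)) (sym (lookup-ε j c))
    where
    to-j : ∀ u v → u - (1ℤ - 0ℤ) * (u - v) ≡ v
    to-j = solve-∀
  ... | no k≢i with k Fin.≟ j
  ...   | yes refl rewrite δ-refl k | δ-≢ (i≢j ∘ sym) = trans (to-i (δ k c) (δ i c)) (sym (lookup-ε i c))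
    where
    to-i : ∀ u v → u - (0ℤ - 1ℤ) * (v - u) ≡ v
    to-i = solve-∀
  ...   | no k≢j rewrite δ-≢ k≢i | δ-≢ k≢j = trans (fixed (δ k c) (δ i c - δ j c)) (sym (lookup-ε k c))
    where
    fixed : ∀ u d → u - (0ℤ - 0ℤ) * d ≡ u
    fixed = solve-∀

reflections-ε : (τs : List (Transposition n)) (k : Fin n) →
  reflections δ (List.map rootOf τs) (ε k) ≡ ε (permuteBy τs k)
reflections-ε List.[]         k = refl
reflections-ε (((i , j) , i≢j) List.∷ τs) k =
  trans (cong (reflectG δ (ε i -ᵥ ε j)) (reflections-ε τs k)) (reflect-ε i j i≢j (permuteBy τs k))

sumV-rootOf : (τ : Transposition n) → sumV (rootOf τ) ≡ 0ℤ
sumV-rootOf ((i , j) , _) = begin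
  sumV (ε i -ᵥ ε j)                          ≡⟨ sumV-∑ (ε i -ᵥ ε j) ⟩
  sum (lookup (ε i -ᵥ ε j))                  ≡⟨ sum-cong-≗ (λ c → trans (lookup-ε-ε i j c) (unit (δ i c) (δ j c))) ⟩
  sum (λ c → 1ℤ * δ i c + - 1ℤ * δ j c)     ≡⟨ ∑-linear 1ℤ (- 1ℤ) (δ i) (δ j) ⟩
  1ℤ * sum (δ i) + - 1ℤ * sum (δ j)          ≡⟨ cong₂ (λ s t → 1ℤ * s + - 1ℤ * t) (∑-δ≡1 i) (∑-δ≡1 j) ⟩
  0ℤ                                         ∎
  where
  open ≡-Reasoning
  unit : ∀ s t → s - t ≡ 1ℤ * s + - 1ℤ * t
  unit = solve-∀

dot-rootOf : (τ : Transposition n) → dot (rootOf τ) (rootOf τ) ≡ + 2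
dot-rootOf ((i , j) , i≢j) rewrite dot-ε-ε i j i j | δ-refl i | δ-refl j | δ-≢ i≢j | δ-≢ (i≢j ∘ sym) = refl

-- The root lattice A_m inside ℤ^(m+1)

subHead : ℤ → Vecℤ (suc n) → Vecℤ (suc n)
subHead a (c ∷ y) = (c - a) ∷ y

-- A_m sits in ℤ^(m+1) (standard form) via α_k ↦ ε_k − ε_(k+1), as the vectors of coordinate sum 0;
-- embedA x has coordinates x_c − x_(c−1), and unembedA takes partial sums.
embedA : Vecℤ m → Vecℤ (suc m)
embedA []      = 0ℤ ∷ []
embedA (a ∷ x) = a ∷ subHead a (embedA x)

unembedA : Vecℤ (suc m) → Vecℤ m
unembedA (b ∷ [])    = []
unembedA (b ∷ c ∷ y) = b ∷ unembedA ((b + c) ∷ y)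

lookup-subHead : (a : ℤ) (u : Vecℤ (suc n)) (c : Fin (suc n)) → lookup (subHead a u) c ≡ lookup u c - δ zero c * a
lookup-subHead a (u₀ ∷ u) zero    = cong (_-_ u₀) (sym (ℤₚ.*-identityˡ a))
lookup-subHead a (u₀ ∷ u) (suc c) = minus-zero (lookup u c) a
  where
  minus-zero : ∀ t a → t ≡ t - 0ℤ * a
  minus-zero = solve-∀

embedA-linear : IsLinear (embedA {m})
embedA-linear {w = []}     {a} {[]}     {b} {[]}     _ = pointwise λ { zero → zero≡ a b }
  where
  zero≡ : ∀ a b → 0ℤ ≡ a * 0ℤ + b * 0ℤ
  zero≡ = solve-∀
embedA-linear {w = w₀ ∷ w} {a} {x₀ ∷ x} {b} {y₀ ∷ y} w≡ax+by = pointwise λ where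
    zero    → at w≡ax+by zero
    (suc c) → begin
      lookup (subHead w₀ (embedA w)) c
        ≡⟨ lookup-subHead w₀ (embedA w) c ⟩
      lookup (embedA w) c - δ zero c * w₀
        ≡⟨ cong₂ (λ s t → s - δ zero c * t) (at (embedA-linear tail-comb) c) (at w≡ax+by zero) ⟩
      (a * lookup (embedA x) c + b * lookup (embedA y) c) - δ zero c * (a * x₀ + b * y₀)
        ≡⟨ regroup a b (lookup (embedA x) c) (lookup (embedA y) c) (δ zero c) x₀ y₀ ⟩
      a * (lookup (embedA x) c - δ zero c * x₀) + b * (lookup (embedA y) c - δ zero c * y₀)
        ≡⟨ sym (cong₂ (λ s t → a * s + b * t) (lookup-subHead x₀ (embedA x) c) (lookup-subHead y₀ (embedA y) c)) ⟩
      a * lookup (subHead x₀ (embedA x)) c + b * lookup (subHead y₀ (embedA y)) c ∎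
  where
  open ≡-Reasoning
  tail-comb : LinComb w a x b y
  tail-comb = pointwise (at w≡ax+by ∘ suc)
  regroup : ∀ a b s t d x₀ y₀ → (a * s + b * t) - d * (a * x₀ + b * y₀) ≡ a * (s - d * x₀) + b * (t - d * y₀)
  regroup = solve-∀

unembedA-subHead : (a : ℤ) (u : Vecℤ (suc n)) → unembedA (a ∷ subHead a u) ≡ a ∷ unembedA u
unembedA-subHead a (c ∷ y) = cong (λ h → a ∷ unembedA (h ∷ y)) (cancel a c)
  where
  cancel : ∀ a c → a + (c - a) ≡ c
  cancel = solve-∀

unembedA-embedA : (x : Vecℤ m) → unembedA (embedA x) ≡ x
unembedA-embedA []      = refl
unembedA-embedA (a ∷ x) = trans (unembedA-subHead a (embedA x)) (cong (a ∷_) (unembedA-embedA x))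

embedA-injective : {x y : Vecℤ m} → embedA x ≡ embedA y → x ≡ y
embedA-injective {x = x} {y} eq = trans (sym (unembedA-embedA x)) (trans (cong unembedA eq) (unembedA-embedA y))

sumV-subHead : (a : ℤ) (u : Vecℤ (suc n)) → sumV (subHead a u) ≡ sumV u - a
sumV-subHead a (c ∷ y) = move c a (sumV y)
  where
  move : ∀ c a s → (c - a) + s ≡ (c + s) - a
  move = solve-∀

sumV-embedA : (x : Vecℤ m) → sumV (embedA x) ≡ 0ℤ
sumV-embedA []      = refl
sumV-embedA (a ∷ x) = trans (cong (_+_ a) (trans (sumV-subHead a (embedA x)) (cong (_- a) (sumV-embedA x)))) (cancel a)
  where
  cancel : ∀ a → a + (0ℤ - a) ≡ 0ℤ
  cancel = solve-∀

embedA-unembedA : (y : Vecℤ (suc m)) → sumV y ≡ 0ℤ → embedA (unembedA y) ≡ y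
embedA-unembedA (b ∷ [])    Σy≡0 = cong (_∷ []) (sym (trans (sym (ℤₚ.+-identityʳ b)) Σy≡0))
embedA-unembedA (b ∷ c ∷ y) Σy≡0 =
  cong (b ∷_) (trans (cong (subHead b) (embedA-unembedA ((b + c) ∷ y) (trans (ℤₚ.+-assoc b c (sumV y)) Σy≡0)))
                     (cong (_∷ y) (cancel b c)))
  where
  cancel : ∀ b c → (b + c) - b ≡ c
  cancel = solve-∀

embedA-ε : (k : Fin m) → embedA (ε k) ≡ ε (inject₁ k) -ᵥ ε (suc k)
embedA-ε {suc m} zero = vec-ext λ where
    zero    → refl
    (suc c) → begin
      lookup (subHead 1ℤ (embedA zeros)) c    ≡⟨ lookup-subHead 1ℤ (embedA zeros) c ⟩
      lookup (embedA zeros) c - δ zero c * 1ℤ ≡⟨ cong (λ t → t - δ zero c * 1ℤ) (embedA-zeros c) ⟩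
      0ℤ - δ zero c * 1ℤ                      ≡⟨ unit (δ zero c) ⟩
      0ℤ - δ zero c                           ≡⟨ sym (lookup-ε-ε zero (suc zero) (suc c)) ⟩
      lookup (ε zero -ᵥ ε (suc zero)) (suc c) ∎
  where
  open ≡-Reasoning
  zeros : Vecℤ m
  zeros = tabulate (λ _ → 0ℤ)
  zeros≡zeroV : zeros ≡ zeroV
  zeros≡zeroV = vec-ext (λ i → trans (lookup∘tabulate (λ _ → 0ℤ) i) (sym (lookup-zeroV i)))
  embedA-zeros : ∀ c → lookup (embedA zeros) c ≡ 0ℤ
  embedA-zeros c = trans (cong (λ z → lookup (embedA z) c) zeros≡zeroV)
                         (trans (cong (λ z → lookup z c) (linear-zeroV embedA-linear)) (lookup-zeroV c))
  unit : ∀ d → 0ℤ - d * 1ℤ ≡ 0ℤ - d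
  unit = solve-∀
embedA-ε {suc m} (suc k) = cong (0ℤ ∷_) (trans (subHead-zero (embedA (ε k))) (embedA-ε k))
  where
  subHead-zero : (u : Vecℤ (suc m)) → subHead 0ℤ u ≡ u
  subHead-zero (c ∷ y) = cong (_∷ y) (ℤₚ.+-identityʳ c)

adjacentToZero : ℕ → ℤ
adjacentToZero zero    = -1ℤ
adjacentToZero (suc _) = 0ℤ

cartanℕ : ℕ → ℕ → ℤ
cartanℕ zero    zero    = + 2
cartanℕ zero    (suc b) = adjacentToZero b
cartanℕ (suc a) zero    = adjacentToZero a
cartanℕ (suc a) (suc b) = cartanℕ a b

cartanℕ-diag : ∀ a → cartanℕ a a ≡ + 2
cartanℕ-diag zero    = refl
cartanℕ-diag (suc a) = cartanℕ-diag a

cartanℕ-above : ∀ a → cartanℕ a (suc a) ≡ -1ℤ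
cartanℕ-above zero    = refl
cartanℕ-above (suc a) = cartanℕ-above a

cartanℕ-below : ∀ a → cartanℕ (suc a) a ≡ -1ℤ
cartanℕ-below zero    = refl
cartanℕ-below (suc a) = cartanℕ-below a

cartanℕ-far : ∀ a b → a ≢ b → suc a ≢ b → suc b ≢ a → cartanℕ a b ≡ 0ℤ
cartanℕ-far zero          zero          a≢b _ _ = ⊥-elim (a≢b refl)
cartanℕ-far zero          (suc zero)    _ a+1≢b _ = ⊥-elim (a+1≢b refl)
cartanℕ-far zero          (suc (suc b)) _ _ _ = refl
cartanℕ-far (suc zero)    zero          _ _ b+1≢a = ⊥-elim (b+1≢a refl)
cartanℕ-far (suc (suc a)) zero          _ _ _ = refl
cartanℕ-far (suc a)       (suc b)       a≢b a+1≢b b+1≢a =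
  cartanℕ-far a b (a≢b ∘ cong suc) (a+1≢b ∘ cong suc) (b+1≢a ∘ cong suc)

OffDiagonal : ℤ → Set
OffDiagonal v = v ≡ 0ℤ ⊎ v ≡ -1ℤ

cartanℕ-off-diagonal : ∀ a b → a ≢ b → OffDiagonal (cartanℕ a b)
cartanℕ-off-diagonal zero          zero          a≢b = ⊥-elim (a≢b refl)
cartanℕ-off-diagonal zero          (suc zero)    _   = inj₂ refl
cartanℕ-off-diagonal zero          (suc (suc b)) _   = inj₁ refl
cartanℕ-off-diagonal (suc zero)    zero          _   = inj₂ refl
cartanℕ-off-diagonal (suc (suc a)) zero          _   = inj₁ refl
cartanℕ-off-diagonal (suc a)       (suc b)       a≢b = cartanℕ-off-diagonal a b (a≢b ∘ cong suc)

cartanA-ℕ : (i j : Fin m) → cartanA m i j ≡ cartanℕ (toℕ i) (toℕ j)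
cartanA-ℕ i j with toℕ i ℕ.≟ toℕ j
... | yes i≡j = sym (trans (cong (λ a → cartanℕ a (toℕ j)) i≡j) (cartanℕ-diag (toℕ j)))
... | no i≢j with suc (toℕ i) ℕ.≟ toℕ j | suc (toℕ j) ℕ.≟ toℕ i
...   | yes i+1≡j | _         = sym (trans (cong (cartanℕ (toℕ i)) (sym i+1≡j)) (cartanℕ-above (toℕ i)))
...   | no _      | yes j+1≡i = sym (trans (cong (λ a → cartanℕ a (toℕ j)) (sym j+1≡i)) (cartanℕ-below (toℕ j)))
...   | no i+1≢j  | no j+1≢i  = sym (cartanℕ-far (toℕ i) (toℕ j) i≢j i+1≢j j+1≢i)

rootDot-simple : (i j : Fin m) → rootDot (inject₁ i) (suc i) (inject₁ j) (suc j) ≡ cartanℕ (toℕ i) (toℕ j)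
rootDot-simple zero          zero          = refl
rootDot-simple zero          (suc zero)    = refl
rootDot-simple zero          (suc (suc j)) = refl
rootDot-simple (suc zero)    zero          = refl
rootDot-simple (suc (suc i)) zero          = refl
rootDot-simple (suc i)       (suc j)       = rootDot-simple i j

formA-embedA : (x y : Vecℤ m) → formA m x y ≡ dot (embedA x) (embedA y)
formA-embedA {m} x y = begin
  bform (cartanA m) x y                   ≡⟨ bform-cong cartan≡gram x y ⟩
  bform (gramOf δ simpleRoots) x y        ≡⟨ sym (bform-lincomb δ δ-sym simpleRoots x y) ⟩
  dot (lincomb simpleRoots x) (lincomb simpleRoots y) ≡⟨ sym (cong₂ dot (embedA-lincomb x) (embedA-lincomb y)) ⟩
  dot (embedA x) (embedA y)               ∎
  where
  open ≡-Reasoning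
  simpleRoots : Vec (Vecℤ (suc m)) m
  simpleRoots = tabulate (embedA ∘ ε)
  embedA-lincomb : (x : Vecℤ m) → embedA x ≡ lincomb simpleRoots x
  embedA-lincomb x = begin
    embedA x                            ≡⟨ cong embedA (sym (lincomb-εs x)) ⟩
    embedA (lincomb (tabulate ε) x)     ≡⟨ linear-lincomb embedA-linear (tabulate ε) x ⟩
    lincomb (map embedA (tabulate ε)) x ≡⟨ cong (λ f → lincomb f x) (sym (tabulate-∘ embedA ε)) ⟩
    lincomb simpleRoots x               ∎
  cartan≡gram : ∀ i j → cartanA m i j ≡ gramOf δ simpleRoots i j
  cartan≡gram i j = begin
    cartanA m i j                                                  ≡⟨ cartanA-ℕ i j ⟩
    cartanℕ (toℕ i) (toℕ j)                                        ≡⟨ sym (rootDot-simple i j) ⟩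
    rootDot (inject₁ i) (suc i) (inject₁ j) (suc j)                ≡⟨ sym (dot-ε-ε (inject₁ i) (suc i) (inject₁ j) (suc j)) ⟩
    dot (ε (inject₁ i) -ᵥ ε (suc i)) (ε (inject₁ j) -ᵥ ε (suc j))  ≡⟨ sym (cong₂ dot (embedA-ε i) (embedA-ε j)) ⟩
    dot (embedA (ε i)) (embedA (ε j))
      ≡⟨ sym (cong₂ dot (lookup∘tabulate (embedA ∘ ε) i) (lookup∘tabulate (embedA ∘ ε) j)) ⟩
    gramOf δ simpleRoots i j                                       ∎

-- Families of roots with the Gram matrix of A_m

Bit : ℤ → Set
Bit u = u ≡ 0ℤ ⊎ u ≡ 1ℤ

δ-bit : (a b : Fin n) → Bit (δ a b)
δ-bit a b with a Fin.≟ b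
... | yes refl = inj₂ (δ-refl a)
... | no a≢b   = inj₁ (δ-≢ a≢b)

rootDot-swap : (a b c d : Fin n) → rootDot b a d c ≡ rootDot a b c d
rootDot-swap a b c d = reorder (δ a c) (δ a d) (δ b c) (δ b d)
  where
  reorder : ∀ ac ad bc bd → bd - bc - ad + ac ≡ ac - ad - bc + bd
  reorder = solve-∀

rootDot-≡-1 : (a b c d : Fin n) → rootDot a b c d ≡ -1ℤ → b ≡ c ⊎ a ≡ d
rootDot-≡-1 a b c d ab·cd≡-1 with b Fin.≟ c | a Fin.≟ d
... | yes b≡c | _       = inj₁ b≡c
... | no _    | yes a≡d = inj₂ a≡d
... | no b≢c  | no a≢d  = ⊥-elim (nonnegative (δ-bit a c) (δ-bit b d)
        (trans (cong₂ (λ u v → δ a c - u - v + δ b d) (sym (δ-≢ a≢d)) (sym (δ-≢ b≢c))) ab·cd≡-1))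
  where
  nonnegative : ∀ {u v} → Bit u → Bit v → u - 0ℤ - 0ℤ + v ≢ -1ℤ
  nonnegative (inj₁ refl) (inj₁ refl) ()
  nonnegative (inj₁ refl) (inj₂ refl) ()
  nonnegative (inj₂ refl) (inj₁ refl) ()
  nonnegative (inj₂ refl) (inj₂ refl) ()

rootDot-sharedEnd : {a b c : Fin n} → a ≢ b → c ≢ b → ¬ OffDiagonal (rootDot a b c b)
rootDot-sharedEnd {a = a} {b} {c} a≢b c≢b
  rewrite δ-≢ a≢b | δ-≢ (c≢b ∘ sym) | δ-refl b = positive (δ-bit a c)
  where
  positive : ∀ {u} → Bit u → ¬ OffDiagonal (u - 0ℤ - 0ℤ + 1ℤ)
  positive (inj₁ refl) (inj₁ ())
  positive (inj₁ refl) (inj₂ ())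
  positive (inj₂ refl) (inj₁ ())
  positive (inj₂ refl) (inj₂ ())

rootDot-sharedStart : {a b c : Fin n} → a ≢ b → c ≢ a → rootDot a b c a ≢ 0ℤ
rootDot-sharedStart {a = a} {b} {c} a≢b c≢a
  rewrite δ-≢ (c≢a ∘ sym) | δ-refl a | δ-≢ (a≢b ∘ sym) = negative (δ-bit b c)
  where
  negative : ∀ {u} → Bit u → 0ℤ - 1ℤ - u + 0ℤ ≢ 0ℤ
  negative (inj₁ refl) ()
  negative (inj₂ refl) ()

rootDot-reversed : {a b : Fin n} → a ≢ b → rootDot a b b a ≢ -1ℤ
rootDot-reversed {a = a} {b} a≢b rewrite δ-≢ a≢b | δ-refl a | δ-refl b | δ-≢ (a≢b ∘ sym) = λ ()

HasCartanGram : (a b : Fin m → Fin n) → Set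
HasCartanGram a b = ∀ i j → rootDot (a i) (b i) (a j) (b j) ≡ cartanℕ (toℕ i) (toℕ j)

hasCartanGram-swap : (a b : Fin m → Fin n) → HasCartanGram a b → HasCartanGram b a
hasCartanGram-swap a b gram i j = trans (rootDot-swap (a i) (b i) (a j) (b j)) (gram i j)

Linked : (a b : Fin (suc m) → Fin n) → Set
Linked {zero}  a b = ⊤
Linked {suc m} a b = b 0F ≡ a 1F × Linked (a ∘ suc) (b ∘ suc)

linked-at : {a b : Fin (suc m) → Fin n} → Linked a b → ∀ k → b (inject₁ k) ≡ a (suc k)
linked-at {suc m} (b₀≡a₁ , _)    zero    = b₀≡a₁
linked-at {suc m} (_ , linked) (suc k) = linked-at linked k

-- The alternative a₁ = b₂ would give b₀ = b₂, but roots with a common endpoint are not orthogonal.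
linked-from-start : (a b : Fin (suc (suc m)) → Fin n) → (∀ k → a k ≢ b k) → HasCartanGram a b →
  b 0F ≡ a 1F → Linked a b
linked-from-start {zero}  a b a≢b gram b₀≡a₁ = b₀≡a₁ , tt
linked-from-start {suc m} a b a≢b gram b₀≡a₁ =
  b₀≡a₁ , linked-from-start (a ∘ suc) (b ∘ suc) (a≢b ∘ suc) (λ i j → gram (suc i) (suc j)) b₁≡a₂
  where
  b₁≡a₂ : b 1F ≡ a 2F
  b₁≡a₂ with rootDot-≡-1 (a 1F) (b 1F) (a 2F) (b 2F) (gram 1F 2F)
  ... | inj₁ b₁≡a₂ = b₁≡a₂
  ... | inj₂ a₁≡b₂ = ⊥-elim (rootDot-sharedEnd (a≢b 0F) a₂≢b₀
                       (inj₁ (subst (λ z → rootDot (a 0F) (b 0F) (a 2F) z ≡ 0ℤ) b₂≡b₀ (gram 0F 2F))))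
    where
    b₂≡b₀ : b 2F ≡ b 0F
    b₂≡b₀ = sym (trans b₀≡a₁ a₁≡b₂)
    a₂≢b₀ : a 2F ≢ b 0F
    a₂≢b₀ a₂≡b₀ = a≢b 2F (trans a₂≡b₀ (sym b₂≡b₀))

linked-either : (a b : Fin (suc m) → Fin n) → (∀ k → a k ≢ b k) → HasCartanGram a b → Linked a b ⊎ Linked b a
linked-either {zero}  a b a≢b gram = inj₁ tt
linked-either {suc m} a b a≢b gram with rootDot-≡-1 (a 0F) (b 0F) (a 1F) (b 1F) (gram 0F 1F)
... | inj₁ b₀≡a₁ = inj₁ (linked-from-start a b a≢b gram b₀≡a₁)
... | inj₂ a₀≡b₁ = inj₂ (linked-from-start b a (λ k → a≢b k ∘ sym) (hasCartanGram-swap a b gram) a₀≡b₁)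

path : (a b : Fin (suc m) → Fin n) → Fin (suc (suc m)) → Fin n
path a b zero    = a zero
path a b (suc k) = b k

path-inject₁ : {a b : Fin (suc m) → Fin n} → Linked a b → ∀ k → path a b (inject₁ k) ≡ a k
path-inject₁ linked zero    = refl
path-inject₁ linked (suc k) = linked-at linked k

path-start≢end : (a b : Fin (suc m) → Fin n) → (∀ k → a k ≢ b k) → HasCartanGram a b → Linked a b →
  ∀ k → a 0F ≢ b k
path-start≢end         a b a≢b gram linked        zero          = a≢b 0F
path-start≢end {suc m} a b a≢b gram (b₀≡a₁ , _) (suc zero)    a₀≡b₁ =
  rootDot-reversed (a≢b 0F) (subst₂ (λ c d → rootDot (a 0F) (b 0F) c d ≡ -1ℤ) (sym b₀≡a₁) (sym a₀≡b₁) (gram 0F 1F))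
path-start≢end {suc m} a b a≢b gram linked        (suc (suc k)) a₀≡bₖ =
  rootDot-sharedStart (a≢b 0F) (λ aₖ≡a₀ → a≢b (suc (suc k)) (trans aₖ≡a₀ a₀≡bₖ))
    (subst (λ d → rootDot (a 0F) (b 0F) (a (suc (suc k))) d ≡ 0ℤ) (sym a₀≡bₖ) (gram 0F (suc (suc k))))

path-ends-injective : (a b : Fin m → Fin n) → (∀ k → a k ≢ b k) → HasCartanGram a b →
  ∀ i j → b i ≡ b j → i ≡ j
path-ends-injective a b a≢b gram i j bᵢ≡bⱼ with i Fin.≟ j
... | yes i≡j = i≡j
... | no i≢j  = ⊥-elim (rootDot-sharedEnd (a≢b i) (λ aⱼ≡bᵢ → a≢b j (trans aⱼ≡bᵢ bᵢ≡bⱼ))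
                  (subst (λ d → OffDiagonal (rootDot (a i) (b i) (a j) d)) (sym bᵢ≡bⱼ)
                    (subst OffDiagonal (sym (gram i j)) (cartanℕ-off-diagonal (toℕ i) (toℕ j) (i≢j ∘ Finₚ.toℕ-injective)))))

path-injective : (a b : Fin (suc m) → Fin n) → (∀ k → a k ≢ b k) → HasCartanGram a b → Linked a b →
  Injective _≡_ _≡_ (path a b)
path-injective a b a≢b gram linked {zero}  {zero}  _     = refl
path-injective a b a≢b gram linked {zero}  {suc k} a₀≡bₖ = ⊥-elim (path-start≢end a b a≢b gram linked k a₀≡bₖ)
path-injective a b a≢b gram linked {suc k} {zero}  bₖ≡a₀ = ⊥-elim (path-start≢end a b a≢b gram linked k (sym bₖ≡a₀))
path-injective a b a≢b gram linked {suc i} {suc j} bᵢ≡bⱼ = cong suc (path-ends-injective a b a≢b gram i j bᵢ≡bⱼ)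

module _ (y : Fin (suc m) → Vecℤ n) (y-root : ∀ k → IsεDifference (y k))
         (y-gram : ∀ i j → dot (y i) (y j) ≡ cartanℕ (toℕ i) (toℕ j)) where

  private
    a b : Fin (suc m) → Fin n
    a k = proj₁ (y-root k)
    b k = proj₁ (proj₂ (y-root k))
    a≢b : ∀ k → a k ≢ b k
    a≢b k = proj₁ (proj₂ (proj₂ (y-root k)))
    y≡εa-εb : ∀ k → y k ≡ ε (a k) -ᵥ ε (b k)
    y≡εa-εb k = proj₂ (proj₂ (proj₂ (y-root k)))
    ab-gram : HasCartanGram a b
    ab-gram i j = trans (sym (dot-ε-ε (a i) (b i) (a j) (b j))) (trans (sym (cong₂ dot (y≡εa-εb i) (y≡εa-εb j))) (y-gram i j))

  cartanRoots-path : Σ[ f ∈ Bool ] Σ[ p ∈ (Fin (suc (suc m)) → Fin n) ]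
    Injective _≡_ _≡_ p × (∀ k → y k ≡ signed f (ε (p (inject₁ k)) -ᵥ ε (p (suc k))))
  cartanRoots-path with linked-either a b a≢b ab-gram
  ... | inj₁ linked = false , path a b , path-injective a b a≢b ab-gram linked , λ k →
    trans (y≡εa-εb k) (cong (λ c → ε c -ᵥ ε (b k)) (sym (path-inject₁ linked k)))
  ... | inj₂ linked = true , path b a , path-injective b a (λ k → a≢b k ∘ sym) (hasCartanGram-swap a b ab-gram) linked , λ k →
    trans (y≡εa-εb k) (trans (-ᵥ-flip (ε (a k)) (ε (b k))) (cong (λ c → -ᵥ (ε c -ᵥ ε (a k))) (sym (path-inject₁ linked k))))

-- Isometries of A_m lie in ±W(A_m)

RootA : ℕ → Set
RootA m = Σ[ r ∈ Vecℤ m ] formA m r r ≡ + 2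

rootA : Transposition (suc m) → RootA m
rootA τ = unembedA (rootOf τ) , (begin
  formA _ (unembedA (rootOf τ)) (unembedA (rootOf τ))         ≡⟨ formA-embedA (unembedA (rootOf τ)) (unembedA (rootOf τ)) ⟩
  dot (embedA (unembedA (rootOf τ))) (embedA (unembedA (rootOf τ))) ≡⟨ cong₂ dot embedA-unembedA-rootOf embedA-unembedA-rootOf ⟩
  dot (rootOf τ) (rootOf τ)                                   ≡⟨ dot-rootOf τ ⟩
  + 2                                                         ∎)
  where
  open ≡-Reasoning
  embedA-unembedA-rootOf : embedA (unembedA (rootOf τ)) ≡ rootOf τ
  embedA-unembedA-rootOf = embedA-unembedA (rootOf τ) (sumV-rootOf τ)

embedA-reflections : (τs : List (Transposition (suc m))) (x : Vecℤ m) →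
  embedA (reflections (cartanA m) (List.map proj₁ (List.map rootA τs)) x) ≡ reflections δ (List.map rootOf τs) (embedA x)
embedA-reflections List.[]         x = refl
embedA-reflections {m} (τ List.∷ τs) x = begin
  embedA (reflectG (cartanA m) r (reflections (cartanA m) rs x))
    ≡⟨ isometry-reflectG {G = cartanA m} {G′ = δ} embedA-linear (λ x y → sym (formA-embedA x y)) r (reflections (cartanA m) rs x) ⟩
  reflectG δ (embedA r) (embedA (reflections (cartanA m) rs x))
    ≡⟨ cong₂ (reflectG δ) (embedA-unembedA (rootOf τ) (sumV-rootOf τ)) (embedA-reflections τs x) ⟩
  reflectG δ (rootOf τ) (reflections δ (List.map rootOf τs) (embedA x)) ∎
  where
  open ≡-Reasoning
  r = proj₁ (rootA τ)
  rs = List.map proj₁ (List.map rootA τs)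

embedA-cartanFamily-path : (v : Fin (suc m) → Vecℤ (suc m)) →
  (∀ i j → formA (suc m) (v i) (v j) ≡ cartanA (suc m) i j) →
  Σ[ f ∈ Bool ] Σ[ p ∈ (Fin (suc (suc m)) → Fin (suc (suc m))) ]
    Injective _≡_ _≡_ p × (∀ k → embedA (v k) ≡ signed f (ε (p (inject₁ k)) -ᵥ ε (p (suc k))))
embedA-cartanFamily-path v v-cartan = cartanRoots-path (embedA ∘ v) y-root y-gram
  where
  y-gram : ∀ i j → dot (embedA (v i)) (embedA (v j)) ≡ cartanℕ (toℕ i) (toℕ j)
  y-gram i j = trans (sym (formA-embedA (v i) (v j))) (trans (v-cartan i j) (cartanA-ℕ i j))
  y-root : ∀ k → IsεDifference (embedA (v k))
  y-root k = root-ε-ε (embedA (v k)) (sumV-embedA (v k)) (trans (y-gram k k) (cartanℕ-diag (toℕ k)))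

cartanFamily-W-conjugate-±simpleRoots : (v : Fin m → Vecℤ m) → (∀ i j → formA m (v i) (v j) ≡ cartanA m i j) →
  Σ[ t ∈ List (RootA m) ] Σ[ b ∈ Bool ] ∀ k → reflections (cartanA m) (List.map proj₁ t) (v k) ≡ signed b (ε k)
cartanFamily-W-conjugate-±simpleRoots {zero}  v v-cartan = List.[] , false , λ ()
cartanFamily-W-conjugate-±simpleRoots {suc m} v v-cartan = List.map rootA τs , f , λ k → embedA-injective (begin
  embedA (reflections (cartanA (suc m)) (List.map proj₁ (List.map rootA τs)) (v k))
                                                           ≡⟨ embedA-reflections τs (v k) ⟩
  R (embedA (v k))                                         ≡⟨ cong R (v-path k) ⟩
  R (signed f (ε (p (inject₁ k)) -ᵥ ε (p (suc k))))        ≡⟨ linear-signed R-linear f _ ⟩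
  signed f (R (ε (p (inject₁ k)) -ᵥ ε (p (suc k))))        ≡⟨ cong (signed f) (linear-subᵥ R-linear _ _) ⟩
  signed f (R (ε (p (inject₁ k))) -ᵥ R (ε (p (suc k))))    ≡⟨ cong (signed f) (cong₂ _-ᵥ_ (sorts (inject₁ k)) (sorts (suc k))) ⟩
  signed f (ε (inject₁ k) -ᵥ ε (suc k))                    ≡⟨ cong (signed f) (sym (embedA-ε k)) ⟩
  signed f (embedA (ε k))                                  ≡⟨ sym (linear-signed embedA-linear f (ε k)) ⟩
  embedA (signed f (ε k))                                  ∎)
  where
  open ≡-Reasoning
  path-data = embedA-cartanFamily-path v v-cartan
  f = proj₁ path-data
  p = proj₁ (proj₂ path-data)
  v-path = proj₂ (proj₂ (proj₂ path-data))
  sorting = sortingTranspositions p (proj₁ (proj₂ (proj₂ path-data)))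
  τs = proj₁ sorting
  R : Vecℤ (suc (suc m)) → Vecℤ (suc (suc m))
  R = reflections δ (List.map rootOf τs)
  R-linear : IsLinear R
  R-linear = reflections-linear δ (List.map rootOf τs)
  sorts : ∀ i → R (ε (p i)) ≡ ε i
  sorts i = trans (reflections-ε τs (p i)) (cong ε (proj₂ sorting i))

-- The groups W(U) and W(U)^±

module _ {U : Lattice} where

  actW-linear : (w : WordW U) → IsLinear (actW U w)
  actW-linear List.[]             = id-linear
  actW-linear ((α , _) List.∷ w) = ∘-linear (reflectG-linear (gram U) α) (actW-linear w)

  actW-isometry : (w : WordW U) (x y : El U) → ⟨ U ⟩[ actW U w x , actW U w y ] ≡ ⟨ U ⟩[ x , y ]
  actW-isometry List.[]              x y = refl
  actW-isometry ((α , α²≡2) List.∷ w) x y =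
    trans (reflectG-isometry (gram U) α (symmetric U) α²≡2 (actW U w x) (actW U w y)) (actW-isometry w x y)

  actW-++ : (w w′ : WordW U) (x : El U) → actW U (w List.++ w′) x ≡ actW U w (actW U w′ x)
  actW-++ List.[]             w′ x = refl
  actW-++ ((α , _) List.∷ w) w′ x = cong (reflect U α) (actW-++ w w′ x)

  actW±-linear : (g : WordW± U) → IsLinear (actW± U g)
  actW±-linear List.[]                            = id-linear
  actW±-linear (refl-gen (α , _) List.∷ g) = ∘-linear (reflectG-linear (gram U) α) (actW±-linear g)
  actW±-linear (neg-gen List.∷ g)                 = ∘-linear (signed-linear true) (actW±-linear g)

  reflectionsOf : WordW± U → WordW U
  reflectionsOf List.[]                   = List.[]
  reflectionsOf (refl-gen α List.∷ g) = α List.∷ reflectionsOf g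
  reflectionsOf (neg-gen List.∷ g)        = reflectionsOf g

  negationParity : WordW± U → Bool
  negationParity List.[]                   = false
  negationParity (refl-gen _ List.∷ g) = negationParity g
  negationParity (neg-gen List.∷ g)        = not (negationParity g)

  actW±-signed : (g : WordW± U) (x : El U) →
    actW± U g x ≡ signed (negationParity g) (actW U (reflectionsOf g) x)
  actW±-signed List.[]                         x = refl
  actW±-signed (refl-gen (α , _) List.∷ g) x =
    trans (cong (reflect U α) (actW±-signed g x))
          (linear-signed (reflectG-linear (gram U) α) (negationParity g) (actW U (reflectionsOf g) x))
  actW±-signed (neg-gen List.∷ g) x with negationParity g | actW±-signed g x
  ... | false | gx≡wx = cong -ᵥ_ gx≡wx
  ... | true  | gx≡-wx = trans (cong -ᵥ_ gx≡-wx) (signed-involutive true (actW U (reflectionsOf g) x))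

  signedWord : Bool → WordW U → WordW± U
  signedWord false w = List.map refl-gen w
  signedWord true  w = neg-gen List.∷ List.map refl-gen w

  actW±-signedWord : ∀ b (w : WordW U) (x : El U) → actW± U (signedWord b w) x ≡ signed b (actW U w x)
  actW±-signedWord false w x = actW±-map w
    where
    actW±-map : (w : WordW U) → actW± U (List.map refl-gen w) x ≡ actW U w x
    actW±-map List.[]             = refl
    actW±-map ((α , _) List.∷ w) = cong (reflect U α) (actW±-map w)
  actW±-signedWord true w x = cong -ᵥ_ (actW±-signedWord false w x)

module _ {m : ℕ} {U : Lattice} where

  ⟦_⟧ : IsoEmb m U → Vecℤ m → El U
  ⟦ e ⟧ = apply {m} {U} (map₀ e)

  embedding-linear : (e : IsoEmb m U) → IsLinear ⟦ e ⟧
  embedding-linear e = lincomb-linear (map₀ e)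

  sameOrbitW±⇒imagesSameOrbitW : (e e′ : IsoEmb m U) → SameOrbitW± e e′ → ImagesSameOrbitW e e′
  sameOrbitW±⇒imagesSameOrbitW e e′ (g , ge≡e′) = w , λ y → into y , outof y
    where
    open ≡-Reasoning
    w = reflectionsOf g
    b = negationParity g
    we±≡e′ : ∀ x → actW U w (⟦ e ⟧ (signed b x)) ≡ ⟦ e′ ⟧ x
    we±≡e′ x = begin
      actW U w (⟦ e ⟧ (signed b x))  ≡⟨ cong (actW U w) (linear-signed (embedding-linear e) b x) ⟩
      actW U w (signed b (⟦ e ⟧ x))  ≡⟨ linear-signed (actW-linear w) b (⟦ e ⟧ x) ⟩
      signed b (actW U w (⟦ e ⟧ x))  ≡⟨ sym (actW±-signed g (⟦ e ⟧ x)) ⟩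
      actW± U g (⟦ e ⟧ x)            ≡⟨ ge≡e′ x ⟩
      ⟦ e′ ⟧ x                       ∎
    into : ∀ y → y ∈Im e′ → ∃ λ x → x ∈Im e × actW U w x ≡ y
    into y (x , e′x≡y) = ⟦ e ⟧ (signed b x) , (signed b x , refl) , trans (we±≡e′ x) e′x≡y
    outof : ∀ y → (∃ λ x → x ∈Im e × actW U w x ≡ y) → y ∈Im e′
    outof y (_ , (z , refl) , wez≡y) = signed b z , (begin
      ⟦ e′ ⟧ (signed b z)                      ≡⟨ sym (we±≡e′ (signed b z)) ⟩
      actW U w (⟦ e ⟧ (signed b (signed b z))) ≡⟨ cong (actW U w ∘ ⟦ e ⟧) (signed-involutive b z) ⟩
      actW U w (⟦ e ⟧ z)                       ≡⟨ wez≡y ⟩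
      y                                        ∎)

  rootImage : IsoEmb m U → RootA m → Root U
  rootImage e (r , r²≡2) = ⟦ e ⟧ r , trans (isometry e r r) r²≡2

  actW-rootImages : (e : IsoEmb m U) (t : List (RootA m)) (x : Vecℤ m) →
    actW U (List.map (rootImage e) t) (⟦ e ⟧ x) ≡ ⟦ e ⟧ (reflections (cartanA m) (List.map proj₁ t) x)
  actW-rootImages e List.[]             x = refl
  actW-rootImages e ((r , _) List.∷ t) x =
    trans (cong (reflect U (⟦ e ⟧ r)) (actW-rootImages e t x))
          (sym (isometry-reflectG (embedding-linear e) (isometry e) r (reflections (cartanA m) (List.map proj₁ t) x)))

  preimages-cartan : (e e′ : IsoEmb m U) (w : WordW U) (v : Fin m → Vecℤ m) →
    (∀ k → ⟦ e′ ⟧ (v k) ≡ actW U w (⟦ e ⟧ (ε k))) → ∀ i j → formA m (v i) (v j) ≡ cartanA m i j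
  preimages-cartan e e′ w v e′v≡we i j = begin
    formA m (v i) (v j)                                       ≡⟨ sym (isometry e′ (v i) (v j)) ⟩
    ⟨ U ⟩[ ⟦ e′ ⟧ (v i) , ⟦ e′ ⟧ (v j) ]                      ≡⟨ cong₂ ⟨ U ⟩[_,_] (e′v≡we i) (e′v≡we j) ⟩
    ⟨ U ⟩[ actW U w (⟦ e ⟧ (ε i)) , actW U w (⟦ e ⟧ (ε j)) ]  ≡⟨ actW-isometry w (⟦ e ⟧ (ε i)) (⟦ e ⟧ (ε j)) ⟩
    ⟨ U ⟩[ ⟦ e ⟧ (ε i) , ⟦ e ⟧ (ε j) ]                        ≡⟨ isometry e (ε i) (ε j) ⟩
    formA m (ε i) (ε j)                                       ≡⟨ bform-ε (cartanA m) i j ⟩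
    cartanA m i j                                             ∎
    where open ≡-Reasoning

  imagesSameOrbitW⇒sameOrbitW± : (e e′ : IsoEmb m U) → ImagesSameOrbitW e e′ → SameOrbitW± e e′
  imagesSameOrbitW⇒sameOrbitW± e e′ (w , w[Im-e]≡Im-e′) = signedWord b (t′ List.++ w) , g∘e≡e′
    where
    open ≡-Reasoning
    preimage : ∀ k → actW U w (⟦ e ⟧ (ε k)) ∈Im e′
    preimage k = proj₂ (w[Im-e]≡Im-e′ (actW U w (⟦ e ⟧ (ε k)))) (⟦ e ⟧ (ε k) , (ε k , refl) , refl)
    v : Fin m → Vecℤ m
    v k = proj₁ (preimage k)
    e′v≡we : ∀ k → ⟦ e′ ⟧ (v k) ≡ actW U w (⟦ e ⟧ (ε k))
    e′v≡we k = proj₂ (preimage k)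
    conjugation = cartanFamily-W-conjugate-±simpleRoots v (preimages-cartan e e′ w v e′v≡we)
    t = proj₁ conjugation
    b = proj₁ (proj₂ conjugation)
    tv≡±ε = proj₂ (proj₂ conjugation)
    t′ = List.map (rootImage e′) t
    on-ε : ∀ k → actW± U (signedWord b (t′ List.++ w)) (⟦ e ⟧ (ε k)) ≡ ⟦ e′ ⟧ (ε k)
    on-ε k = begin
      actW± U (signedWord b (t′ List.++ w)) (⟦ e ⟧ (ε k))  ≡⟨ actW±-signedWord b (t′ List.++ w) (⟦ e ⟧ (ε k)) ⟩
      signed b (actW U (t′ List.++ w) (⟦ e ⟧ (ε k)))       ≡⟨ cong (signed b) (actW-++ t′ w (⟦ e ⟧ (ε k))) ⟩
      signed b (actW U t′ (actW U w (⟦ e ⟧ (ε k))))        ≡⟨ cong (signed b ∘ actW U t′) (sym (e′v≡we k)) ⟩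
      signed b (actW U t′ (⟦ e′ ⟧ (v k)))                  ≡⟨ cong (signed b) (actW-rootImages e′ t (v k)) ⟩
      signed b (⟦ e′ ⟧ (reflections (cartanA m) (List.map proj₁ t) (v k)))
                                                           ≡⟨ cong (signed b ∘ ⟦ e′ ⟧) (tv≡±ε k) ⟩
      signed b (⟦ e′ ⟧ (signed b (ε k)))                   ≡⟨ cong (signed b) (linear-signed (embedding-linear e′) b (ε k)) ⟩
      signed b (signed b (⟦ e′ ⟧ (ε k)))                   ≡⟨ signed-involutive b (⟦ e′ ⟧ (ε k)) ⟩
      ⟦ e′ ⟧ (ε k)                                         ∎
    g∘e≡e′ : ∀ x → actW± U (signedWord b (t′ List.++ w)) (⟦ e ⟧ x) ≡ ⟦ e′ ⟧ x
    g∘e≡e′ = linear-ext (∘-linear (actW±-linear (signedWord b (t′ List.++ w))) (embedding-linear e))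
                        (embedding-linear e′) on-ε

lemma7p6 : (U : Lattice) (m : ℕ) → 1 ≤ m → (e e' : IsoEmb m U) →
    (SameOrbitW± e e' → ImagesSameOrbitW e e') × (ImagesSameOrbitW e e' → SameOrbitW± e e')
lemma7p6 U m _ e e' = sameOrbitW±⇒imagesSameOrbitW e e' , imagesSameOrbitW⇒sameOrbitW± e e'
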